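{- Let $n \geq 2$ and $d \geq n$. Then \[ \max_{D \in \mathcal{D}_1(n,d)} p_{\textsc{Cluster}}(D) = \Theta(\min(1, nd/m)) \quad\text{and}\quad \max_{D \in \mathcal{D}_1(n,d)} p_{\textsc{Random}}(D) = \Theta(\min(1, d^2/m)). \]
   Context: Fix $m\in\mathbb N$ and the universe of IDs $[m]=\{1,\dots,m\}$. An ID-generation algorithm $\mathcal A$ is a probability distribution over permutations of $[m]$: an instance draws a permutation and answers its $t$-th request with the $t$-th entry. A demand profile $D=(d_1,\dots,d_n)\in[m]^n$ means $n$ instances with independent randomness, instance $i$ receiving $d_i$ requests. A collision occurs if the sets of IDs output by the instances are not pairwise disjoint; $p_{\mathcal A}(D)$ is the collision probability. $\mathcal D_1(n,d)=\{D\in[m]^n : \sum_i d_i = d\}$. Cluster: pick $x\in[m]$ uniformly at random and return $x,x+1,\dots$ modulo $m$. Random returns the IDs of $[m]$ in uniformly random order. Asymptotic notation is non-asymptotic: $\Theta$ hides absolute constants independent of all parameters. -}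

module Defs where

open import Data.Nat as ℕ using (ℕ; zero; suc; _+_; _*_; _^_; _<ᵇ_; _≤_)
open import Data.Bool using (Bool; true; false; _∧_; _∨_; not; if_then_else_)
open import Data.Fin as Fin using (Fin; toℕ; fromℕ<)
open import Data.Fin.Properties using (_≟_)
open import Data.List as List using (List; []; _∷_; length; filter; concatMap; allFin; map)
open import Data.Bool.ListAction using (any)
open import Data.Vec as Vec using (Vec; []; _∷_; lookup; toList)
open import Data.Integer using (+_)
open import Data.Rational as ℚ using (ℚ; 0ℚ; 1ℚ; _/_)
open import Data.Product using (_×_; ∃-syntax)
open import Data.Vec.Relation.Unary.All using (All)
open import Relation.Nullary using (does)

_==_ : ∀ {m} → Fin m → Fin m → Bool
x == y = does (x ≟ y)

-- a / b as a rational (with the irrelevant convention a / 0 = 0).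
frac : ℕ → ℕ → ℚ
frac a zero = 0ℚ
frac a (suc b) = (+ a) / suc b

vecsOf : ∀ {A : Set} → List A → (k : ℕ) → List (Vec A k)
vecsOf xs zero = [] ∷ []
vecsOf xs (suc k) = concatMap (λ x → map (x ∷_) (vecsOf xs k)) xs

-- Permutations of [m] are represented as the vector (σ(1),…,σ(m)) of their
-- entries; an instance answers its t-th request with the t-th entry.
Perm : ℕ → Set
Perm m = Vec (Fin m) m

distinctL : ∀ {m} → List (Fin m) → Bool
distinctL [] = true
distinctL (x ∷ xs) = not (any (x ==_) xs) ∧ distinctL xs

allPerms : (m : ℕ) → List (Perm m)
allPerms m = filter (λ v → Relation.Nullary.Decidable.Core.T? (distinctL (toList v))) (vecsOf (allFin m) m)
  where import Relation.Nullary.Decidable.Core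

-- An ID-generation algorithm with a uniform distribution over a finite list
-- of permutations (multiplicities allowed).  Both Cluster and Random are of this form.
Algorithm : ℕ → Set
Algorithm m = List (Perm m)

cluster : (m : ℕ) → Algorithm m
cluster zero = []
cluster (suc k) = map (λ x → Vec.tabulate (λ t → shift x t)) (allFin (suc k))
  where
  shift : Fin (suc k) → Fin (suc k) → Fin (suc k)
  shift x t = Fin.fromℕ< (Data.Nat.DivMod.m%n<n (toℕ x + toℕ t) (suc k))
    where import Data.Nat.DivMod

random : (m : ℕ) → Algorithm m
random m = allPerms m

outputs : ∀ {m} → Perm m → ℕ → List (Fin m)
outputs {m} σ d = map (lookup σ) (filter (λ t → Relation.Nullary.Decidable.Core.T? (toℕ t <ᵇ d)) (allFin m))
  where import Relation.Nullary.Decidable.Core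

collides : ∀ {m n} → Vec ℕ n → Vec (Perm m) n → Bool
collides {m} {n} D σs =
  any (λ i → any (λ j → not (i == j) ∧
        any (λ x → any (x ==_) (outputs (lookup σs j) (lookup D j)))
            (outputs (lookup σs i) (lookup D i)))
      (allFin n)) (allFin n)

countColl : ∀ {m n} → Algorithm m → Vec ℕ n → ℕ
countColl {m} {n} A D = length (filter (λ σs → Relation.Nullary.Decidable.Core.T? (collides D σs)) (vecsOf A n))
  where import Relation.Nullary.Decidable.Core

collProb : ∀ {m n} → Algorithm m → Vec ℕ n → ℚ
collProb {m} {n} A D = frac (countColl A D) (length A ^ n)

InD1 : (m n d : ℕ) → Vec ℕ n → Set
InD1 m n d D = All (λ di → 1 ≤ di × di ≤ m) D × Vec.sum D Relation.Binary.PropositionalEquality.≡ d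
  where import Relation.Binary.PropositionalEquality

MaxBetween : (m n d : ℕ) → (Vec ℕ n → ℚ) → ℚ → ℚ → ℚ → Set
MaxBetween m n d p c₁ c₂ b =
  (∃[ D ] (InD1 m n d D × c₁ ℚ.* b ℚ.≤ p D)) ×
  (∀ D → InD1 m n d D → p D ℚ.≤ c₂ ℚ.* b)

module Submission where

-- Upper bounds: by the union bound over pairs of instances, m · p(D) ≤ Σ_{i ≠ j} w(d_i, d_j),
-- where two Cluster instances collide with probability at most (d_i + d_j) / m (the second start
-- must fall in a window of length d_i + d_j) and two Random instances with probability at most
-- d_i d_j / m; summing gives 2 n d / m and d² / m.
-- Lower bounds: take the profile (1, …, 1, ⌊L/2⌋, ⌈L/2⌉) with L = d − n + 2. Revealing the
-- instances one at a time, each must avoid the IDs of the later ones, so by the chain rule the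
-- probability of no collision is at most m / (m + T), where T grows like n d for Cluster and like
-- d² for Random. When L > 2m this profile does not fit, but then some profile contains a demand
-- of m, which collides surely.

open import Defs
open import Data.Bool using (Bool; true; false; _∧_; _∨_; not; T)
open import Data.Bool.ListAction using (any)
open import Data.Bool.Properties using (∧-assoc; ∧-identityʳ; T-∧)
open import Data.Empty using (⊥; ⊥-elim)
open import Data.Fin using (Fin; toℕ; fromℕ<) renaming (zero to fz; suc to fs)
open import Data.Fin.Properties using (_≟_; toℕ-fromℕ<; toℕ-injective; toℕ<n)
open import Data.Integer as ℤ using (+≤+)
import Data.Integer.Properties as ℤP
open import Data.List using (List; []; _∷_; length; filter; concatMap; map; _++_; allFin; upTo)
open import Data.List.Properties using (length-map; length-++; map-tabulate; length-tabulate; length-upTo)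
open import Data.List.Membership.Propositional using (_∈_; lose; find)
open import Data.List.Membership.Propositional.Properties using (∈-allFin; ∈-++⁻; ∈-map⁺; ∈-map⁻; ∈-filter⁺; ∈-filter⁻; ∈-upTo⁺)
open import Data.List.Relation.Unary.Any using (here; there)
open import Data.List.Relation.Unary.Any.Properties using (any⁺; any⁻)
open import Data.List.Relation.Unary.All as LA using ([]; _∷_)
open import Data.List.Relation.Unary.Unique.Propositional using (Unique)
import Data.List.Relation.Unary.Unique.Propositional.Properties as UP
import Data.List.Relation.Unary.AllPairs as AP
open import Data.Nat as ℕ using (ℕ; zero; suc; _+_; _*_; _^_; _≤_; _<_; _∸_; z≤n; s≤s; _<ᵇ_; NonZero; >-nonZero)
open import Data.Nat.Properties hiding (_≟_)
open import Data.Nat.DivMod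
open import Data.Nat.Tactic.RingSolver using (solve-∀)
open import Data.Product using (_×_; _,_; ∃-syntax; proj₁; proj₂)
open import Data.Rational as ℚ using (0ℚ; 1ℚ; toℚᵘ; _⊓_)
import Data.Rational.Properties as ℚP
open import Data.Rational.Unnormalised as ℚᵘ using (mkℚᵘ; *≤*)
import Data.Rational.Unnormalised.Properties as ℚᵘP
open import Data.Sum using (_⊎_; inj₁; inj₂)
open import Data.Unit using (tt)
open import Data.Vec as Vec using (Vec; []; _∷_; _∷ʳ_; lookup; toList)
open import Data.Vec.Properties using (lookup∘tabulate)
open import Data.Vec.Relation.Unary.All using (All; []; _∷_)
open import Data.Vec.Relation.Unary.All.Properties using (lookup⁺)
open import Function.Bundles using (module Equivalence)
open import Relation.Binary.PropositionalEquality
open import Relation.Nullary using (yes; no; ¬_)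
open import Relation.Nullary.Decidable using (toWitness)
open import Relation.Nullary.Decidable.Core using (T?)

open Equivalence using (to; from)

𝟙 : Bool → ℕ
𝟙 true = 1
𝟙 false = 0

∑ : ∀ {a} {A : Set a} → (A → ℕ) → List A → ℕ
∑ g [] = 0
∑ g (x ∷ xs) = g x + ∑ g xs

countᵇ : ∀ {a} {A : Set a} → (A → Bool) → List A → ℕ
countᵇ f = ∑ (λ x → 𝟙 (f x))

module _ {a} {A : Set a} where

  length-filter : (f : A → Bool) (xs : List A) → length (filter (λ x → T? (f x)) xs) ≡ countᵇ f xs
  length-filter f [] = refl
  length-filter f (x ∷ xs) with f x
  ... | true = cong suc (length-filter f xs)
  ... | false = length-filter f xs

  ∑-filter : (f : A → Bool) (g : A → ℕ) (xs : List A) → ∑ g (filter (λ x → T? (f x)) xs) ≡ ∑ (λ x → 𝟙 (f x) * g x) xs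
  ∑-filter f g [] = refl
  ∑-filter f g (x ∷ xs) with f x
  ... | true = cong₂ _+_ (sym (+-identityʳ (g x))) (∑-filter f g xs)
  ... | false = ∑-filter f g xs

  ∑-mono : {g h : A → ℕ} (xs : List A) → (∀ x → x ∈ xs → g x ≤ h x) → ∑ g xs ≤ ∑ h xs
  ∑-mono [] p = z≤n
  ∑-mono (x ∷ xs) p = +-mono-≤ (p x (here refl)) (∑-mono xs (λ y q → p y (there q)))

  ∑-cong : {g h : A → ℕ} (xs : List A) → (∀ x → x ∈ xs → g x ≡ h x) → ∑ g xs ≡ ∑ h xs
  ∑-cong [] p = refl
  ∑-cong (x ∷ xs) p = cong₂ _+_ (p x (here refl)) (∑-cong xs (λ y q → p y (there q)))

  ∑-+ : (g h : A → ℕ) (xs : List A) → ∑ (λ x → g x + h x) xs ≡ ∑ g xs + ∑ h xs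
  ∑-+ g h [] = refl
  ∑-+ g h (x ∷ xs) rewrite ∑-+ g h xs = +-interchange (g x) (h x) (∑ g xs) (∑ h xs)
    where
    +-interchange : ∀ p q r s → (p + q) + (r + s) ≡ (p + r) + (q + s)
    +-interchange = solve-∀

  ∑-*ˡ : (c : ℕ) (g : A → ℕ) (xs : List A) → ∑ (λ x → c * g x) xs ≡ c * ∑ g xs
  ∑-*ˡ c g [] = sym (*-zeroʳ c)
  ∑-*ˡ c g (x ∷ xs) = trans (cong (c * g x +_) (∑-*ˡ c g xs)) (sym (*-distribˡ-+ c (g x) (∑ g xs)))

  ∑-*ʳ : (c : ℕ) (g : A → ℕ) (xs : List A) → ∑ (λ x → g x * c) xs ≡ ∑ g xs * c
  ∑-*ʳ c g xs = trans (∑-cong xs (λ x _ → *-comm (g x) c)) (trans (∑-*ˡ c g xs) (*-comm c (∑ g xs)))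

  ∑-const : (c : ℕ) (xs : List A) → ∑ (λ _ → c) xs ≡ c * length xs
  ∑-const c [] = sym (*-zeroʳ c)
  ∑-const c (x ∷ xs) = trans (cong (c +_) (∑-const c xs)) (sym (*-suc c (length xs)))

  ∑-++ : (g : A → ℕ) (xs ys : List A) → ∑ g (xs ++ ys) ≡ ∑ g xs + ∑ g ys
  ∑-++ g [] ys = refl
  ∑-++ g (x ∷ xs) ys = trans (cong (g x +_) (∑-++ g xs ys)) (sym (+-assoc (g x) _ _))

  ∑-zero : (g : A → ℕ) (xs : List A) → (∀ x → x ∈ xs → g x ≡ 0) → ∑ g xs ≡ 0
  ∑-zero g xs p = trans (∑-cong xs p) (∑-const 0 xs)

  countᵇ≤length : (f : A → Bool) (xs : List A) → countᵇ f xs ≤ length xs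
  countᵇ≤length f [] = z≤n
  countᵇ≤length f (x ∷ xs) with f x
  ... | true = s≤s (countᵇ≤length f xs)
  ... | false = m≤n⇒m≤1+n (countᵇ≤length f xs)

module _ {a b} {A : Set a} {B : Set b} where

  ∑-map : (g : B → ℕ) (h : A → B) (xs : List A) → ∑ g (map h xs) ≡ ∑ (λ x → g (h x)) xs
  ∑-map g h [] = refl
  ∑-map g h (x ∷ xs) = cong (g (h x) +_) (∑-map g h xs)

  ∑-concatMap : (g : B → ℕ) (h : A → List B) (xs : List A) → ∑ g (concatMap h xs) ≡ ∑ (λ x → ∑ g (h x)) xs
  ∑-concatMap g h [] = refl
  ∑-concatMap g h (x ∷ xs) = trans (∑-++ g (h x) (concatMap h xs)) (cong (∑ g (h x) +_) (∑-concatMap g h xs))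

  ∑-comm : (f : A → B → ℕ) (xs : List A) (ys : List B) → ∑ (λ x → ∑ (λ y → f x y) ys) xs ≡ ∑ (λ y → ∑ (λ x → f x y) xs) ys
  ∑-comm f [] ys = sym (∑-zero _ ys (λ _ _ → refl))
  ∑-comm f (x ∷ xs) ys = trans (cong (∑ (f x) ys +_) (∑-comm f xs ys)) (sym (∑-+ (f x) (λ y → ∑ (λ x → f x y) xs) ys))

𝟙-∧ : ∀ a b → 𝟙 (a ∧ b) ≡ 𝟙 a * 𝟙 b
𝟙-∧ true b = sym (+-identityʳ (𝟙 b))
𝟙-∧ false b = refl

𝟙-∨ : ∀ a b → 𝟙 (a ∨ b) ≤ 𝟙 a + 𝟙 b
𝟙-∨ true b = s≤s z≤n
𝟙-∨ false b = ≤-refl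

𝟙-not : ∀ a → 𝟙 (not a) + 𝟙 a ≡ 1
𝟙-not true = refl
𝟙-not false = refl

𝟙-T : ∀ {a} → T a → 𝟙 a ≡ 1
𝟙-T {true} _ = refl

𝟙-¬T : ∀ {a} → (T a → ⊥) → 𝟙 a ≡ 0
𝟙-¬T {true} p = ⊥-elim (p tt)
𝟙-¬T {false} p = refl

𝟙-mono : ∀ {a b} → (T a → T b) → 𝟙 a ≤ 𝟙 b
𝟙-mono {true} {true} p = ≤-refl
𝟙-mono {true} {false} p = ⊥-elim (p tt)
𝟙-mono {false} p = z≤n

module _ {a} {A : Set a} where
  𝟙-any≤countᵇ : (f : A → Bool) (xs : List A) → 𝟙 (any f xs) ≤ countᵇ f xs
  𝟙-any≤countᵇ f [] = z≤n
  𝟙-any≤countᵇ f (x ∷ xs) = ≤-trans (𝟙-∨ (f x) (any f xs)) (+-monoʳ-≤ (𝟙 (f x)) (𝟙-any≤countᵇ f xs))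

  countᵇ-mono : {f g : A → Bool} (xs : List A) → (∀ x → x ∈ xs → T (f x) → T (g x)) → countᵇ f xs ≤ countᵇ g xs
  countᵇ-mono xs p = ∑-mono xs (λ x q → 𝟙-mono (p x q))

  countᵇ≤1⇒≡𝟙-any : (f : A → Bool) (xs : List A) → countᵇ f xs ≤ 1 → countᵇ f xs ≡ 𝟙 (any f xs)
  countᵇ≤1⇒≡𝟙-any f [] p = refl
  countᵇ≤1⇒≡𝟙-any f (x ∷ xs) p with f x
  ... | true = cong suc (n≤0⇒n≡0 (≤-pred p))
  ... | false = countᵇ≤1⇒≡𝟙-any f xs p

  countᵇ-not+countᵇ : (f : A → Bool) (xs : List A) → countᵇ (λ x → not (f x)) xs + countᵇ f xs ≡ length xs
  countᵇ-not+countᵇ f xs = trans (sym (∑-+ (λ x → 𝟙 (not (f x))) (λ x → 𝟙 (f x)) xs))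
                   (trans (∑-cong xs (λ x _ → 𝟙-not (f x))) (trans (∑-const 1 xs) (*-identityˡ _)))

  countᵇ≡length∸countᵇ-not : (f : A → Bool) (xs : List A) → countᵇ f xs ≡ length xs ∸ countᵇ (λ x → not (f x)) xs
  countᵇ≡length∸countᵇ-not f xs =
    trans (sym (m+n∸m≡n (countᵇ (λ x → not (f x)) xs) (countᵇ f xs))) (cong (_∸ countᵇ (λ x → not (f x)) xs) (countᵇ-not+countᵇ f xs))

T-not : ∀ {a} → ¬ T a → T (not a)
T-not {true} p = p tt
T-not {false} p = tt

T-not⁻ : ∀ {a} → T (not a) → ¬ T a
T-not⁻ {true} p q = p

module _ {a} {A : Set a} where
  any-intro : (f : A → Bool) {x : A} {xs : List A} → x ∈ xs → T (f x) → T (any f xs)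
  any-intro f x∈xs fx = any⁺ f (lose x∈xs fx)

  any-elim : (f : A → Bool) (xs : List A) → T (any f xs) → ∃[ x ] (x ∈ xs × T (f x))
  any-elim f xs p = find (any⁻ f xs p)

module _ {m : ℕ} where
  ==→≡ : {x y : Fin m} → T (x == y) → x ≡ y
  ==→≡ {x} {y} p with x ≟ y
  ... | yes x≡y = x≡y

  ≡→== : {x y : Fin m} → x ≡ y → T (x == y)
  ≡→== {x} {y} x≡y with x ≟ y
  ... | yes _ = tt
  ... | no x≢y = x≢y x≡y

  intersects : List (Fin m) → List (Fin m) → Bool
  intersects L M = any (λ x → any (x ==_) M) L

  intersects-intro : {x : Fin m} {L M : List (Fin m)} → x ∈ L → x ∈ M → T (intersects L M)
  intersects-intro {x} {L} {M} p q = any-intro (λ x → any (x ==_) M) p (any-intro (x ==_) q (≡→== {x} refl))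

  intersects-elim : (L M : List (Fin m)) → T (intersects L M) → ∃[ x ] (x ∈ L × x ∈ M)
  intersects-elim L M p with any-elim _ L p
  ... | x , xL , q with any-elim _ M q
  ... | y , yM , e rewrite ==→≡ {x} {y} e = y , xL , yM

length≡∑1 : ∀ {a} {A : Set a} (L : List A) → length L ≡ ∑ (λ _ → 1) L
length≡∑1 [] = refl
length≡∑1 (x ∷ L) = cong suc (length≡∑1 L)

module _ {A : Set} (xs : List A) where
  ∑-vecsOf-suc : (k : ℕ) (g : Vec A (suc k) → ℕ) → ∑ g (vecsOf xs (suc k)) ≡ ∑ (λ x → ∑ (λ v → g (x ∷ v)) (vecsOf xs k)) xs
  ∑-vecsOf-suc k g = trans (∑-concatMap g _ xs) (∑-cong xs (λ x _ → ∑-map g (x ∷_) (vecsOf xs k)))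

  length-vecsOf : (k : ℕ) → length (vecsOf xs k) ≡ length xs ^ k
  length-vecsOf zero = refl
  length-vecsOf (suc k) = begin
      length (vecsOf xs (suc k))
    ≡⟨ length≡∑1 (vecsOf xs (suc k)) ⟩
      ∑ (λ _ → 1) (vecsOf xs (suc k))
    ≡⟨ ∑-vecsOf-suc k (λ _ → 1) ⟩
      ∑ (λ x → ∑ (λ _ → 1) (vecsOf xs k)) xs
    ≡⟨ ∑-cong xs (λ x _ → trans (sym (length≡∑1 (vecsOf xs k))) (length-vecsOf k)) ⟩
      ∑ (λ x → length xs ^ k) xs
    ≡⟨ ∑-const _ xs ⟩
      length xs ^ k * length xs
    ≡⟨ *-comm (length xs ^ k) (length xs) ⟩
      length xs ^ suc k ∎
    where open ≡-Reasoning

  ∑-vecsOf-mono : (k : ℕ) {g h : Vec A k → ℕ} → (∀ v → All (_∈ xs) v → g v ≤ h v) → ∑ g (vecsOf xs k) ≤ ∑ h (vecsOf xs k)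
  ∑-vecsOf-mono zero p = +-monoˡ-≤ 0 (p [] [])
  ∑-vecsOf-mono (suc k) {g} {h} p = begin
      ∑ g (vecsOf xs (suc k))
    ≡⟨ ∑-vecsOf-suc k g ⟩
      ∑ (λ x → ∑ (λ v → g (x ∷ v)) (vecsOf xs k)) xs
    ≤⟨ ∑-mono xs (λ x x∈ → ∑-vecsOf-mono k (λ v a → p (x ∷ v) (x∈ ∷ a))) ⟩
      ∑ (λ x → ∑ (λ v → h (x ∷ v)) (vecsOf xs k)) xs
    ≡⟨ sym (∑-vecsOf-suc k h) ⟩
      ∑ h (vecsOf xs (suc k)) ∎
    where open ≤-Reasoning

  ∑-vecsOf-lookup : (k : ℕ) (g : A → ℕ) (j : Fin (suc k)) → ∑ (λ v → g (lookup v j)) (vecsOf xs (suc k)) ≡ ∑ g xs * length xs ^ k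
  ∑-vecsOf-lookup k g fz = begin
      ∑ (λ v → g (lookup v fz)) (vecsOf xs (suc k))
    ≡⟨ ∑-vecsOf-suc k _ ⟩
      ∑ (λ x → ∑ (λ v → g x) (vecsOf xs k)) xs
    ≡⟨ ∑-cong xs (λ x _ → trans (∑-const (g x) (vecsOf xs k)) (cong (g x *_) (length-vecsOf k))) ⟩
      ∑ (λ x → g x * length xs ^ k) xs
    ≡⟨ ∑-*ʳ _ g xs ⟩
      ∑ g xs * length xs ^ k ∎
    where open ≡-Reasoning
  ∑-vecsOf-lookup (suc k) g (fs j) = begin
      ∑ (λ v → g (lookup v (fs j))) (vecsOf xs (suc (suc k)))
    ≡⟨ ∑-vecsOf-suc (suc k) _ ⟩
      ∑ (λ x → ∑ (λ v → g (lookup v j)) (vecsOf xs (suc k))) xs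
    ≡⟨ ∑-cong xs (λ x _ → ∑-vecsOf-lookup k g j) ⟩
      ∑ (λ x → ∑ g xs * length xs ^ k) xs
    ≡⟨ ∑-const _ xs ⟩
      ∑ g xs * length xs ^ k * length xs
    ≡⟨ *-assoc (∑ g xs) _ _ ⟩
      ∑ g xs * (length xs ^ k * length xs)
    ≡⟨ cong (∑ g xs *_) (*-comm (length xs ^ k) (length xs)) ⟩
      ∑ g xs * length xs ^ suc k ∎
    where open ≡-Reasoning

  ∑-vecsOf-lookup₂ : (k : ℕ) (f : A → A → ℕ) (i j : Fin (suc (suc k))) → i ≢ j →
          ∑ (λ v → f (lookup v i) (lookup v j)) (vecsOf xs (suc (suc k))) ≡ ∑ (λ x → ∑ (f x) xs) xs * length xs ^ k
  ∑-vecsOf-lookup₂ k f fz fz ne = ⊥-elim (ne refl)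
  ∑-vecsOf-lookup₂ k f fz (fs j) ne = begin
      _
    ≡⟨ ∑-vecsOf-suc (suc k) _ ⟩
      ∑ (λ x → ∑ (λ v → f x (lookup v j)) (vecsOf xs (suc k))) xs
    ≡⟨ ∑-cong xs (λ x _ → ∑-vecsOf-lookup k (f x) j) ⟩
      ∑ (λ x → ∑ (f x) xs * length xs ^ k) xs
    ≡⟨ ∑-*ʳ _ _ xs ⟩
      ∑ (λ x → ∑ (f x) xs) xs * length xs ^ k ∎
    where open ≡-Reasoning
  ∑-vecsOf-lookup₂ k f (fs i) fz ne = begin
      _
    ≡⟨ ∑-vecsOf-suc (suc k) _ ⟩
      ∑ (λ x → ∑ (λ v → f (lookup v i) x) (vecsOf xs (suc k))) xs
    ≡⟨ ∑-cong xs (λ x _ → ∑-vecsOf-lookup k (λ y → f y x) i) ⟩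
      ∑ (λ x → ∑ (λ y → f y x) xs * length xs ^ k) xs
    ≡⟨ ∑-*ʳ _ _ xs ⟩
      ∑ (λ x → ∑ (λ y → f y x) xs) xs * length xs ^ k
    ≡⟨ cong (_* length xs ^ k) (sym (∑-comm f xs xs)) ⟩
      ∑ (λ x → ∑ (f x) xs) xs * length xs ^ k ∎
    where open ≡-Reasoning
  ∑-vecsOf-lookup₂ zero f (fs fz) (fs fz) ne = ⊥-elim (ne refl)
  ∑-vecsOf-lookup₂ (suc k) f (fs i) (fs j) ne = begin
      _
    ≡⟨ ∑-vecsOf-suc (suc (suc k)) _ ⟩
      ∑ (λ x → ∑ (λ v → f (lookup v i) (lookup v j)) (vecsOf xs (suc (suc k)))) xs
    ≡⟨ ∑-cong xs (λ x _ → ∑-vecsOf-lookup₂ k f i j (λ e → ne (cong fs e))) ⟩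
      ∑ (λ x → W * length xs ^ k) xs
    ≡⟨ ∑-const _ xs ⟩
      W * length xs ^ k * length xs
    ≡⟨ *-assoc W _ _ ⟩
      W * (length xs ^ k * length xs)
    ≡⟨ cong (W *_) (*-comm (length xs ^ k) (length xs)) ⟩
      W * length xs ^ suc k ∎
    where
    open ≡-Reasoning
    W = ∑ (λ x → ∑ (f x) xs) xs

∑-allFin-suc : ∀ {n} (g : Fin (suc n) → ℕ) → ∑ g (allFin (suc n)) ≡ g fz + ∑ (λ t → g (fs t)) (allFin n)
∑-allFin-suc {n} g = cong (g fz +_) (trans (cong (∑ g) (sym (map-tabulate (λ t → t) fs))) (∑-map g fs (allFin n)))

length-allFin : ∀ n → length (allFin n) ≡ n
length-allFin n = length-tabulate (λ x → x)

countᵇ-<ᵇ : ∀ m d → countᵇ (λ (t : Fin m) → toℕ t <ᵇ d) (allFin m) ≡ d ℕ.⊓ m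
countᵇ-<ᵇ zero d = sym (⊓-zeroʳ d)
countᵇ-<ᵇ (suc m) zero = ∑-zero _ (allFin (suc m)) (λ _ _ → refl)
countᵇ-<ᵇ (suc m) (suc d) = trans (∑-allFin-suc {m} (λ t → 𝟙 (toℕ t <ᵇ suc d))) (cong suc (countᵇ-<ᵇ m d))

Demand : ℕ → ℕ → Set
Demand m x = 1 ≤ x × x ≤ m

module _ {m : ℕ} where
  length-outputs : (σ : Perm m) (d : ℕ) → d ≤ m → length (outputs σ d) ≡ d
  length-outputs σ d d≤m = trans (length-map (lookup σ) (filter (λ t → T? (toℕ t <ᵇ d)) (allFin m))) (trans (length-filter (λ t → toℕ t <ᵇ d) (allFin m)) (trans (countᵇ-<ᵇ m d) (m≤n⇒m⊓n≡m d≤m)))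

  outputs-unique : (σ : Perm m) (d : ℕ) → (∀ {s t} → lookup σ s ≡ lookup σ t → s ≡ t) → Unique (outputs σ d)
  outputs-unique σ d inj = UP.map⁺ inj (UP.filter⁺ (λ t → T? (toℕ t <ᵇ d)) (UP.allFin⁺ m))

  ∈-outputs⁻ : {σ : Perm m} {d : ℕ} {x : Fin m} → x ∈ outputs σ d → ∃[ t ] (toℕ t < d × lookup σ t ≡ x)
  ∈-outputs⁻ {σ} {d} p with ∈-map⁻ (lookup σ) p
  ... | t , q , e = t , <ᵇ⇒< (toℕ t) d (proj₂ (∈-filter⁻ (λ t → T? (toℕ t <ᵇ d)) {xs = allFin m} q)) , sym e

  ∈-outputs⁺ : {σ : Perm m} {d : ℕ} (t : Fin m) → toℕ t < d → lookup σ t ∈ outputs σ d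
  ∈-outputs⁺ {σ} {d} t lt = ∈-map⁺ (lookup σ) (∈-filter⁺ (λ t → T? (toℕ t <ᵇ d)) (∈-allFin t) (<⇒<ᵇ lt))

  allOutputs : ∀ {n} → Vec ℕ n → Vec (Perm m) n → List (Fin m)
  allOutputs [] [] = []
  allOutputs (d ∷ D) (σ ∷ σs) = outputs σ d ++ allOutputs D σs

  collidesAt : ∀ {n} → Vec ℕ n → Vec (Perm m) n → Fin n → Fin n → Bool
  collidesAt D σs i j = not (i == j) ∧ intersects (outputs (lookup σs i) (lookup D i)) (outputs (lookup σs j) (lookup D j))

  collidesFrom : ∀ {n} → Vec ℕ n → Vec (Perm m) n → Fin n → Bool
  collidesFrom {n} D σs i = any (collidesAt D σs i) (allFin n)

  collides-tail : ∀ {n} (d : ℕ) (D : Vec ℕ n) (σ : Perm m) (σs : Vec (Perm m) n) → T (collides D σs) → T (collides (d ∷ D) (σ ∷ σs))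
  collides-tail {n} d D σ σs p with any-elim (collidesFrom D σs) (allFin n) p
  ... | i , _ , q with any-elim (collidesAt D σs i) (allFin n) q
  ... | j , _ , r =
     any-intro (collidesFrom (d ∷ D) (σ ∷ σs)) (∈-allFin (fs i)) (any-intro (collidesAt (d ∷ D) (σ ∷ σs) (fs i)) (∈-allFin (fs j)) r)

  ∈-allOutputs⁻ : ∀ {n} (D : Vec ℕ n) (σs : Vec (Perm m) n) {x : Fin m} → x ∈ allOutputs D σs → ∃[ j ] (x ∈ outputs (lookup σs j) (lookup D j))
  ∈-allOutputs⁻ [] [] ()
  ∈-allOutputs⁻ (d ∷ D) (σ ∷ σs) p with ∈-++⁻ (outputs σ d) p
  ... | inj₁ q = fz , q
  ... | inj₂ q with ∈-allOutputs⁻ D σs q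
  ... | j , r = fs j , r

  collides-head : ∀ {n} (d : ℕ) (D : Vec ℕ n) (σ : Perm m) (σs : Vec (Perm m) n) → T (intersects (outputs σ d) (allOutputs D σs)) → T (collides (d ∷ D) (σ ∷ σs))
  collides-head {n} d D σ σs p with intersects-elim (outputs σ d) (allOutputs D σs) p
  ... | x , x∈ , xU with ∈-allOutputs⁻ D σs xU
  ... | j , xj = any-intro (collidesFrom (d ∷ D) (σ ∷ σs)) (∈-allFin fz) (any-intro (collidesAt (d ∷ D) (σ ∷ σs) fz) (∈-allFin (fs j)) (from T-∧ (tt , intersects-intro x∈ xj)))

  ¬collides-∷ : ∀ {n} (d : ℕ) (D : Vec ℕ n) (σ : Perm m) (σs : Vec (Perm m) n) →
     T (not (collides (d ∷ D) (σ ∷ σs))) → T (not (collides D σs) ∧ not (intersects (outputs σ d) (allOutputs D σs)))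
  ¬collides-∷ d D σ σs p = from T-∧ (T-not (λ q → T-not⁻ p (collides-tail d D σ σs q)) , T-not (λ q → T-not⁻ p (collides-head d D σ σs q)))

  allOutputs-disjoint : (A : List (Perm m)) → (∀ σ → σ ∈ A → ∀ {s t} → lookup σ s ≡ lookup σ t → s ≡ t) →
     ∀ {n} (D : Vec ℕ n) (σs : Vec (Perm m) n) → All (Demand m) D → All (_∈ A) σs →
     T (not (collides D σs)) → Unique (allOutputs D σs) × length (allOutputs D σs) ≡ Vec.sum D
  allOutputs-disjoint A inj [] [] _ _ _ = AP.[] , refl
  allOutputs-disjoint A inj (d ∷ D) (σ ∷ σs) ((_ , d≤m) ∷ aD) (σ∈ ∷ aσ) p with ¬collides-∷ d D σ σs p
  ... | q with allOutputs-disjoint A inj D σs aD aσ (proj₁ (to T-∧ q))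
  ... | uq , len = UP.++⁺ (outputs-unique σ d (inj σ σ∈)) uq (λ { (x∈ , xU) → T-not⁻ (proj₂ (to (T-∧ {not (collides D σs)}) q)) (intersects-intro x∈ xU) })
                 , trans (length-++ (outputs σ d)) (cong₂ _+_ (length-outputs σ d d≤m) len)

sumWith : (ℕ → ℕ) → ∀ {n} → Vec ℕ n → ℕ
sumWith e [] = 0
sumWith e (d ∷ D) = e d + sumWith e D

avoidProduct : (ℕ → ℕ → ℕ) → ∀ {n} → Vec ℕ n → ℕ
avoidProduct G [] = 1
avoidProduct G (d ∷ D) = G (Vec.sum D) d * avoidProduct G D

module _ {m : ℕ} (A : List (Perm m)) where

  countColl≡countᵇ : ∀ {n} (D : Vec ℕ n) → countColl A D ≡ countᵇ (collides D) (vecsOf A n)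
  countColl≡countᵇ {n} D = length-filter (collides D) (vecsOf A n)

  pairCollisions-bound : (k : ℕ) (D : Vec ℕ (suc (suc k))) (i j : Fin (suc (suc k))) (w : ℕ) →
       (i ≢ j → m * ∑ (λ σ → ∑ (λ τ → 𝟙 (intersects (outputs σ (lookup D i)) (outputs τ (lookup D j)))) A) A ≤ w * length A ^ 2) →
       m * ∑ (λ v → 𝟙 (collidesAt D v i j)) (vecsOf A (suc (suc k))) ≤ w * length A ^ suc (suc k)
  pairCollisions-bound k D i j w h with i ≟ j
  ... | yes refl = ≤-trans (≤-reflexive (trans (cong (m *_) (∑-zero _ (vecsOf A (suc (suc k))) (λ _ _ → refl))) (*-zeroʳ m))) z≤n
  ... | no i≢j = begin
        m * ∑ (λ v → f (lookup v i) (lookup v j)) (vecsOf A (suc (suc k)))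
      ≡⟨ cong (m *_) (∑-vecsOf-lookup₂ A k f i j i≢j) ⟩
        m * (∑ (λ x → ∑ (f x) A) A * length A ^ k)
      ≡⟨ sym (*-assoc m _ _) ⟩
        m * ∑ (λ x → ∑ (f x) A) A * length A ^ k
      ≤⟨ *-monoˡ-≤ (length A ^ k) (h i≢j) ⟩
        w * length A ^ 2 * length A ^ k
      ≡⟨ lem w (length A) (length A ^ k) ⟩
        w * length A ^ suc (suc k) ∎
    where
    open ≤-Reasoning
    f : Perm m → Perm m → ℕ
    f σ τ = 𝟙 (intersects (outputs σ (lookup D i)) (outputs τ (lookup D j)))
    lem : ∀ w a b → w * (a * (a * 1)) * b ≡ w * (a * (a * b))
    lem = solve-∀

  𝟙-collides≤∑collidesAt : ∀ {n} (D : Vec ℕ n) (v : Vec (Perm m) n) → 𝟙 (collides D v) ≤ ∑ (λ i → ∑ (λ j → 𝟙 (collidesAt D v i j)) (allFin n)) (allFin n)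
  𝟙-collides≤∑collidesAt {n} D v = ≤-trans (𝟙-any≤countᵇ (collidesFrom D v) (allFin n)) (∑-mono (allFin n) (λ i _ → 𝟙-any≤countᵇ (collidesAt D v i) (allFin n)))

  union-bound : (k : ℕ) (D : Vec ℕ (suc (suc k))) (w : Fin (suc (suc k)) → Fin (suc (suc k)) → ℕ) →
       (∀ i j → i ≢ j → m * ∑ (λ σ → ∑ (λ τ → 𝟙 (intersects (outputs σ (lookup D i)) (outputs τ (lookup D j)))) A) A ≤ w i j * length A ^ 2) →
       m * countColl A D ≤ ∑ (λ i → ∑ (w i) (allFin (suc (suc k)))) (allFin (suc (suc k))) * length A ^ suc (suc k)
  union-bound k D w h = begin
      m * countColl A D
    ≡⟨ cong (m *_) (countColl≡countᵇ D) ⟩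
      m * ∑ (λ v → 𝟙 (collides D v)) Vs
    ≤⟨ *-monoʳ-≤ m (∑-mono Vs (λ v _ → 𝟙-collides≤∑collidesAt D v)) ⟩
      m * ∑ (λ v → ∑ (λ i → ∑ (λ j → 𝟙 (collidesAt D v i j)) Fs) Fs) Vs
    ≡⟨ cong (m *_) (∑-comm (λ v i → ∑ (λ j → 𝟙 (collidesAt D v i j)) Fs) Vs Fs) ⟩
      m * ∑ (λ i → ∑ (λ v → ∑ (λ j → 𝟙 (collidesAt D v i j)) Fs) Vs) Fs
    ≡⟨ cong (m *_) (∑-cong Fs (λ i _ → ∑-comm (λ v j → 𝟙 (collidesAt D v i j)) Vs Fs)) ⟩
      m * ∑ (λ i → ∑ (λ j → ∑ (λ v → 𝟙 (collidesAt D v i j)) Vs) Fs) Fs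
    ≡⟨ sym (∑-*ˡ m _ Fs) ⟩
      ∑ (λ i → m * ∑ (λ j → ∑ (λ v → 𝟙 (collidesAt D v i j)) Vs) Fs) Fs
    ≡⟨ ∑-cong Fs (λ i _ → sym (∑-*ˡ m (λ j → ∑ (λ v → 𝟙 (collidesAt D v i j)) Vs) Fs)) ⟩
      ∑ (λ i → ∑ (λ j → m * ∑ (λ v → 𝟙 (collidesAt D v i j)) Vs) Fs) Fs
    ≤⟨ ∑-mono Fs (λ i _ → ∑-mono Fs (λ j _ → pairCollisions-bound k D i j (w i j) (h i j))) ⟩
      ∑ (λ i → ∑ (λ j → w i j * length A ^ suc (suc k)) Fs) Fs
    ≡⟨ ∑-cong Fs (λ i _ → ∑-*ʳ _ (w i) Fs) ⟩
      ∑ (λ i → ∑ (w i) Fs * length A ^ suc (suc k)) Fs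
    ≡⟨ ∑-*ʳ _ (λ i → ∑ (w i) Fs) Fs ⟩
      ∑ (λ i → ∑ (w i) Fs) Fs * length A ^ suc (suc k) ∎
    where
    open ≤-Reasoning
    Vs = vecsOf A (suc (suc k))
    Fs = allFin (suc (suc k))

  noCollision-∷≤ : ∀ {n} (d : ℕ) (D : Vec ℕ n) →
    countᵇ (λ v → not (collides (d ∷ D) v)) (vecsOf A (suc n))
      ≤ ∑ (λ v → 𝟙 (not (collides D v)) * countᵇ (λ σ → not (intersects (outputs σ d) (allOutputs D v))) A) (vecsOf A n)
  noCollision-∷≤ {n} d D = begin
      countᵇ (λ v → not (collides (d ∷ D) v)) (vecsOf A (suc n))
    ≡⟨ ∑-vecsOf-suc A n _ ⟩
      ∑ (λ σ → ∑ (λ v → 𝟙 (not (collides (d ∷ D) (σ ∷ v)))) Vs) A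
    ≤⟨ ∑-mono A (λ σ _ → ∑-mono Vs (λ v _ → split σ v)) ⟩
      ∑ (λ σ → ∑ (λ v → 𝟙 (not (collides D v)) * avoids σ v) Vs) A
    ≡⟨ ∑-comm _ A Vs ⟩
      ∑ (λ v → ∑ (λ σ → 𝟙 (not (collides D v)) * avoids σ v) A) Vs
    ≡⟨ ∑-cong Vs (λ v _ → ∑-*ˡ (𝟙 (not (collides D v))) (λ σ → avoids σ v) A) ⟩
      ∑ (λ v → 𝟙 (not (collides D v)) * ∑ (λ σ → avoids σ v) A) Vs ∎
    where
    open ≤-Reasoning
    Vs = vecsOf A n
    avoids : Perm m → Vec (Perm m) n → ℕ
    avoids σ v = 𝟙 (not (intersects (outputs σ d) (allOutputs D v)))
    split : ∀ σ v → 𝟙 (not (collides (d ∷ D) (σ ∷ v))) ≤ 𝟙 (not (collides D v)) * avoids σ v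
    split σ v = ≤-trans (𝟙-mono (¬collides-∷ d D σ v)) (≤-reflexive (𝟙-∧ (not (collides D v)) _))

  -- Probabilities are kept as counts: hyp says that an instance with d requests avoids a
  -- given set of s IDs with probability at most G s d / m ^ e d.
  module _ (e : ℕ → ℕ) (G : ℕ → ℕ → ℕ)
    (hyp : ∀ d → 1 ≤ d → d ≤ m → (Sl : List (Fin m)) → Unique Sl →
           m ^ e d * countᵇ (λ σ → not (intersects (outputs σ d) Sl)) A ≤ length A * G (length Sl) d)
    (inj : ∀ σ → σ ∈ A → ∀ {s t} → lookup σ s ≡ lookup σ t → s ≡ t) where

    avoid-step : ∀ {n} (d : ℕ) (D : Vec ℕ n) → 1 ≤ d → d ≤ m → All (Demand m) D →
      ∀ v → All (_∈ A) v →
      m ^ e d * (𝟙 (not (collides D v)) * countᵇ (λ σ → not (intersects (outputs σ d) (allOutputs D v))) A)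
        ≤ 𝟙 (not (collides D v)) * (length A * G (Vec.sum D) d)
    avoid-step d D 1≤d d≤m aD v av with not (collides D v) in eq
    ... | false = ≤-reflexive (*-zeroʳ (m ^ e d))
    ... | true with allOutputs-disjoint A inj D v aD av (subst T (sym eq) tt)
    ... | unique , length≡sum = begin
          m ^ e d * (1 * countᵇ (λ σ → not (intersects (outputs σ d) (allOutputs D v))) A)
        ≡⟨ cong (m ^ e d *_) (*-identityˡ _) ⟩
          m ^ e d * countᵇ (λ σ → not (intersects (outputs σ d) (allOutputs D v))) A
        ≤⟨ hyp d 1≤d d≤m (allOutputs D v) unique ⟩
          length A * G (length (allOutputs D v)) d
        ≡⟨ cong (λ x → length A * G x d) length≡sum ⟩
          length A * G (Vec.sum D) d
        ≡⟨ sym (*-identityˡ _) ⟩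
          1 * (length A * G (Vec.sum D) d) ∎
      where open ≤-Reasoning

    chain-rule-bound : ∀ {n} (D : Vec ℕ n) → All (Demand m) D →
      m ^ sumWith e D * countᵇ (λ v → not (collides D v)) (vecsOf A n) ≤ length A ^ n * avoidProduct G D
    chain-rule-bound [] [] = ≤-refl
    chain-rule-bound {suc n} (d ∷ D) ((1≤d , d≤m) ∷ aD) = begin
        m ^ (e d + sumWith e D) * countᵇ (λ v → not (collides (d ∷ D) v)) (vecsOf A (suc n))
      ≡⟨ cong (_* noCollisions) (^-distribˡ-+-* m (e d) (sumWith e D)) ⟩
        m ^ e d * m ^ sumWith e D * noCollisions
      ≡⟨ trans (cong (_* noCollisions) (*-comm (m ^ e d) (m ^ sumWith e D))) (*-assoc (m ^ sumWith e D) (m ^ e d) _) ⟩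
        m ^ sumWith e D * (m ^ e d * countᵇ (λ v → not (collides (d ∷ D) v)) (vecsOf A (suc n)))
      ≤⟨ *-monoʳ-≤ (m ^ sumWith e D) (*-monoʳ-≤ (m ^ e d) (noCollision-∷≤ d D)) ⟩
        m ^ sumWith e D * (m ^ e d * ∑ (λ v → 𝟙 (not (collides D v)) * avoiding v) Vs)
      ≡⟨ cong (m ^ sumWith e D *_) (sym (∑-*ˡ (m ^ e d) _ Vs)) ⟩
        m ^ sumWith e D * ∑ (λ v → m ^ e d * (𝟙 (not (collides D v)) * avoiding v)) Vs
      ≤⟨ *-monoʳ-≤ (m ^ sumWith e D) (∑-vecsOf-mono A n (avoid-step d D 1≤d d≤m aD)) ⟩
        m ^ sumWith e D * ∑ (λ v → 𝟙 (not (collides D v)) * (length A * G (Vec.sum D) d)) Vs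
      ≡⟨ trans (cong (m ^ sumWith e D *_) (∑-*ʳ _ _ Vs)) (sym (*-assoc (m ^ sumWith e D) _ _)) ⟩
        m ^ sumWith e D * countᵇ (λ v → not (collides D v)) Vs * (length A * G (Vec.sum D) d)
      ≤⟨ *-monoˡ-≤ _ (chain-rule-bound D aD) ⟩
        length A ^ n * avoidProduct G D * (length A * G (Vec.sum D) d)
      ≡⟨ lem (length A ^ n) (avoidProduct G D) (length A) (G (Vec.sum D) d) ⟩
        length A * length A ^ n * (G (Vec.sum D) d * avoidProduct G D) ∎
      where
      open ≤-Reasoning
      Vs = vecsOf A n
      avoiding : Vec (Perm m) n → ℕ
      avoiding v = countᵇ (λ σ → not (intersects (outputs σ d) (allOutputs D v))) A
      noCollisions = countᵇ (λ v → not (collides (d ∷ D) v)) (vecsOf A (suc n))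
      lem : ∀ a b c g → a * b * (c * g) ≡ c * a * (g * b)
      lem = solve-∀

T-ext : ∀ {a b} → (T a → T b) → (T b → T a) → a ≡ b
T-ext {true} {true} p q = refl
T-ext {true} {false} p q = ⊥-elim (p tt)
T-ext {false} {true} p q = ⊥-elim (q tt)
T-ext {false} {false} p q = refl

module _ {m : ℕ} where
  ==-sym : (x y : Fin m) → (x == y) ≡ (y == x)
  ==-sym x y = T-ext (λ p → ≡→== {y = x} (sym (==→≡ {x = x} {y = y} p))) (λ p → ≡→== {y = y} (sym (==→≡ {x = y} {y = x} p)))

  countᵇ-inj≤1 : ∀ {A : Set} (g : A → Fin m) → (∀ {y y'} → g y ≡ g y' → y ≡ y') →
              (L : List A) → Unique L → (r : Fin m) → countᵇ (λ y → g y == r) L ≤ 1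
  countᵇ-inj≤1 g inj [] u r = z≤n
  countᵇ-inj≤1 g inj (y ∷ L) (ny AP.∷ u) r with g y == r in eq
  ... | false = countᵇ-inj≤1 g inj L u r
  ... | true = s≤s (≤-reflexive (∑-zero _ L (λ y' y'∈ → 𝟙-¬T (λ q → LA.lookup ny y'∈ (inj (trans (==→≡ (subst T (sym eq) tt)) (sym (==→≡ q))))))))

  countᵇ-==≤1 : (L : List (Fin m)) → Unique L → (r : Fin m) → countᵇ (λ y → y == r) L ≤ 1
  countᵇ-==≤1 = countᵇ-inj≤1 (λ y → y) (λ e → e)

  countᵇ-∈≥1 : (f : Fin m → Bool) (L : List (Fin m)) {z : Fin m} → z ∈ L → T (f z) → 1 ≤ countᵇ f L
  countᵇ-∈≥1 f (x ∷ L) (here refl) p rewrite 𝟙-T p = s≤s z≤n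
  countᵇ-∈≥1 f (x ∷ L) (there q) p = ≤-trans (countᵇ-∈≥1 f L q p) (m≤n+m _ _)

  countᵇ-==≡1 : (L : List (Fin m)) → Unique L → {z : Fin m} → z ∈ L → countᵇ (λ y → y == z) L ≡ 1
  countᵇ-==≡1 L u {z} z∈ = ≤-antisym (countᵇ-==≤1 L u _) (countᵇ-∈≥1 _ L z∈ (≡→== {x = z} refl))

  countᵇ-any-== : (xs Sl : List (Fin m)) → Unique xs → Unique Sl → LA.All (_∈ xs) Sl →
           countᵇ (λ y → any (y ==_) Sl) xs ≡ length Sl
  countᵇ-any-== xs Sl uxs uSl allSl = begin
      countᵇ (λ y → any (y ==_) Sl) xs
    ≡⟨ ∑-cong xs (λ y _ → sym (countᵇ≤1⇒≡𝟙-any (y ==_) Sl (≤-trans (≤-reflexive (∑-cong Sl (λ z _ → cong 𝟙 (==-sym y z)))) (countᵇ-==≤1 Sl uSl y)))) ⟩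
      ∑ (λ y → countᵇ (y ==_) Sl) xs
    ≡⟨ ∑-comm (λ y z → 𝟙 (y == z)) xs Sl ⟩
      ∑ (λ z → countᵇ (λ y → y == z) xs) Sl
    ≡⟨ ∑-cong Sl (λ z z∈ → countᵇ-==≡1 xs uxs (LA.lookup allSl z∈)) ⟩
      ∑ (λ _ → 1) Sl
    ≡⟨ sym (length≡∑1 Sl) ⟩
      length Sl ∎
    where open ≡-Reasoning

  countᵇ-not-any-== : (xs Sl : List (Fin m)) → Unique xs → Unique Sl → LA.All (_∈ xs) Sl →
           countᵇ (λ y → not (any (y ==_) Sl)) xs ≡ length xs ∸ length Sl
  countᵇ-not-any-== xs Sl uxs uSl allSl = begin
      countᵇ (λ y → not (any (y ==_) Sl)) xs
    ≡⟨ sym (m+n∸n≡m _ (length Sl)) ⟩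
      countᵇ (λ y → not (any (y ==_) Sl)) xs + length Sl ∸ length Sl
    ≡⟨ cong (λ z → countᵇ (λ y → not (any (y ==_) Sl)) xs + z ∸ length Sl) (sym (countᵇ-any-== xs Sl uxs uSl allSl)) ⟩
      countᵇ (λ y → not (any (y ==_) Sl)) xs + countᵇ (λ y → any (y ==_) Sl) xs ∸ length Sl
    ≡⟨ cong (_∸ length Sl) (countᵇ-not+countᵇ (λ y → any (y ==_) Sl) xs) ⟩
      length xs ∸ length Sl ∎
    where open ≡-Reasoning

  countᵇ-inj≤length : ∀ {A : Set} (p : A → Bool) (g : A → Fin m) → (∀ {y y'} → g y ≡ g y' → y ≡ y') →
             (L : List A) → Unique L → (R : List (Fin m)) → (∀ y → T (p y) → g y ∈ R) → countᵇ p L ≤ length R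
  countᵇ-inj≤length p g inj L uL R h = begin
      countᵇ p L
    ≤⟨ ∑-mono L (λ y _ → step y) ⟩
      ∑ (λ y → countᵇ (λ r → g y == r) R) L
    ≡⟨ ∑-comm (λ y r → 𝟙 (g y == r)) L R ⟩
      ∑ (λ r → countᵇ (λ y → g y == r) L) R
    ≤⟨ ∑-mono R (λ r _ → countᵇ-inj≤1 g inj L uL r) ⟩
      ∑ (λ _ → 1) R
    ≡⟨ sym (length≡∑1 R) ⟩
      length R ∎
    where
    open ≤-Reasoning
    step : ∀ y → 𝟙 (p y) ≤ countᵇ (λ r → g y == r) R
    step y with p y in eq
    ... | false = z≤n
    ... | true = countᵇ-∈≥1 (λ r → g y == r) R (h y (subst T (sym eq) tt)) (≡→== {x = g y} refl)

falling : ℕ → ℕ → ℕ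
falling N zero = 1
falling N (suc b) = N * falling (N ∸ 1) b

falling-sucʳ : ∀ N b → falling N (suc b) ≡ falling N b * (N ∸ b)
falling-sucʳ N zero = trans (*-identityʳ N) (sym (+-identityʳ N))
falling-sucʳ N (suc b) = begin
    N * falling (N ∸ 1) (suc b)
  ≡⟨ cong (N *_) (falling-sucʳ (N ∸ 1) b) ⟩
    N * (falling (N ∸ 1) b * (N ∸ 1 ∸ b))
  ≡⟨ sym (*-assoc N _ _) ⟩
    N * falling (N ∸ 1) b * (N ∸ 1 ∸ b)
  ≡⟨ cong (N * falling (N ∸ 1) b *_) (∸-+-assoc N 1 b) ⟩
    N * falling (N ∸ 1) b * (N ∸ suc b) ∎
  where open ≡-Reasoning

falling-+ : ∀ N d r → falling N (d + r) ≡ falling N d * falling (N ∸ d) r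
falling-+ N zero r = sym (+-identityʳ (falling N r))
falling-+ N (suc d) r = begin
    N * falling (N ∸ 1) (d + r)
  ≡⟨ cong (N *_) (falling-+ (N ∸ 1) d r) ⟩
    N * (falling (N ∸ 1) d * falling (N ∸ 1 ∸ d) r)
  ≡⟨ sym (*-assoc N _ _) ⟩
    N * falling (N ∸ 1) d * falling (N ∸ 1 ∸ d) r
  ≡⟨ cong (λ z → N * falling (N ∸ 1) d * falling z r) (∸-+-assoc N 1 d) ⟩
    N * falling (N ∸ 1) d * falling (N ∸ suc d) r ∎
  where open ≡-Reasoning

1≤falling-self : ∀ N → 1 ≤ falling N N
1≤falling-self zero = ≤-refl
1≤falling-self (suc N) = ≤-trans (1≤falling-self N) (m≤m+n (falling N N) _)

falling-mono : ∀ {N N'} b → N ≤ N' → falling N b ≤ falling N' b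
falling-mono zero le = ≤-refl
falling-mono {N} {N'} (suc b) le = *-mono-≤ le (falling-mono b (∸-monoˡ-≤ 1 le))

N*[N∸s∸d]≤[N∸d]*[N∸s] : ∀ N s d → N * (N ∸ s ∸ d) ≤ (N ∸ d) * (N ∸ s)
N*[N∸s∸d]≤[N∸d]*[N∸s] N s d = begin
    N * (x ∸ d)
  ≡⟨ *-distribˡ-∸ N x d ⟩
    N * x ∸ N * d
  ≤⟨ ∸-monoʳ-≤ (N * x) dx≤Nd ⟩
    N * x ∸ d * x
  ≡⟨ sym (*-distribʳ-∸ x N d) ⟩
    (N ∸ d) * x ∎
  where
  open ≤-Reasoning
  x = N ∸ s
  dx≤Nd : d * x ≤ N * d
  dx≤Nd = ≤-trans (*-monoʳ-≤ d (m∸n≤m N s)) (≤-reflexive (*-comm d N))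

^*falling≤falling*^ : ∀ N s d → N ^ d * falling (N ∸ s) d ≤ falling N d * (N ∸ s) ^ d
^*falling≤falling*^ N s zero = ≤-refl
^*falling≤falling*^ N s (suc d) = begin
    N * N ^ d * falling (N ∸ s) (suc d)
  ≡⟨ cong (N * N ^ d *_) (falling-sucʳ (N ∸ s) d) ⟩
    N * N ^ d * (falling (N ∸ s) d * (N ∸ s ∸ d))
  ≡⟨ lem1 N (N ^ d) (falling (N ∸ s) d) (N ∸ s ∸ d) ⟩
    (N ^ d * falling (N ∸ s) d) * (N * (N ∸ s ∸ d))
  ≤⟨ *-mono-≤ (^*falling≤falling*^ N s d) (N*[N∸s∸d]≤[N∸d]*[N∸s] N s d) ⟩
    (falling N d * (N ∸ s) ^ d) * ((N ∸ d) * (N ∸ s))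
  ≡⟨ lem2 (falling N d) ((N ∸ s) ^ d) (N ∸ d) (N ∸ s) ⟩
    (falling N d * (N ∸ d)) * ((N ∸ s) * (N ∸ s) ^ d)
  ≡⟨ cong (_* ((N ∸ s) * (N ∸ s) ^ d)) (sym (falling-sucʳ N d)) ⟩
    falling N (suc d) * ((N ∸ s) * (N ∸ s) ^ d) ∎
  where
  open ≤-Reasoning
  lem1 : ∀ a b c e → a * b * (c * e) ≡ (b * c) * (a * e)
  lem1 = solve-∀
  lem2 : ∀ a b c e → (a * b) * (c * e) ≡ (a * c) * (e * b)
  lem2 = solve-∀

falling-pascal : ∀ N b → falling N (suc b) ≤ falling (N ∸ 1) (suc b) + suc b * falling (N ∸ 1) b
falling-pascal zero b = z≤n
falling-pascal (suc M) b = begin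
    suc M * falling M b
  ≤⟨ *-monoˡ-≤ (falling M b) (≤-trans (s≤s (≤-trans (m≤n+m∸n M b) (≤-reflexive (+-comm b (M ∸ b))))) (≤-reflexive (sym (+-suc (M ∸ b) b)))) ⟩
    (M ∸ b + suc b) * falling M b
  ≡⟨ *-distribʳ-+ (falling M b) (M ∸ b) (suc b) ⟩
    (M ∸ b) * falling M b + suc b * falling M b
  ≡⟨ cong (_+ suc b * falling M b) (trans (*-comm (M ∸ b) (falling M b)) (sym (falling-sucʳ M b))) ⟩
    falling M (suc b) + suc b * falling M b ∎
  where open ≤-Reasoning

falling-∸-diff : ∀ m a b → falling m (suc b) ≤ falling (m ∸ a) (suc b) + a * suc b * falling (m ∸ 1) b
falling-∸-diff m zero b = m≤m+n _ _
falling-∸-diff m (suc a) b = begin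
    falling m (suc b)
  ≤⟨ falling-∸-diff m a b ⟩
    falling (m ∸ a) (suc b) + a * suc b * falling (m ∸ 1) b
  ≤⟨ +-monoˡ-≤ _ (falling-pascal (m ∸ a) b) ⟩
    falling (m ∸ a ∸ 1) (suc b) + suc b * falling (m ∸ a ∸ 1) b + a * suc b * falling (m ∸ 1) b
  ≤⟨ +-monoˡ-≤ _ (+-monoʳ-≤ (falling (m ∸ a ∸ 1) (suc b)) (*-monoʳ-≤ (suc b) (falling-mono b (∸-monoˡ-≤ 1 (m∸n≤m m a))))) ⟩
    falling (m ∸ a ∸ 1) (suc b) + suc b * falling (m ∸ 1) b + a * suc b * falling (m ∸ 1) b
  ≡⟨ cong₂ _+_ (cong₂ _+_ (cong (λ z → falling z (suc b)) (trans (∸-+-assoc m a 1) (cong (m ∸_) (+-comm a 1)))) refl) refl ⟩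
    falling (m ∸ suc a) (suc b) + suc b * falling (m ∸ 1) b + a * suc b * falling (m ∸ 1) b
  ≡⟨ lem (falling (m ∸ suc a) (suc b)) (suc b) (falling (m ∸ 1) b) a ⟩
    falling (m ∸ suc a) (suc b) + suc a * suc b * falling (m ∸ 1) b ∎
  where
  open ≤-Reasoning
  lem : ∀ x y z a → x + y * z + a * y * z ≡ x + (1 + a) * y * z
  lem = solve-∀

-- With R counting the completions of a b-prefix to a permutation, this says that b distinct
-- uniformly random IDs meet a fixed set of a IDs with probability at most a b / m.
hit-bound : ∀ m a b R → m * (falling m b * R ∸ falling (m ∸ a) b * R) ≤ a * b * (falling m b * R)
hit-bound m a zero R = ≤-trans (≤-reflexive (trans (cong (m *_) (n∸n≡0 (1 * R))) (*-zeroʳ m))) z≤n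
hit-bound m a (suc b) R = begin
    m * (X * R ∸ Y * R)
  ≡⟨ cong (m *_) (sym (*-distribʳ-∸ R X Y)) ⟩
    m * ((X ∸ Y) * R)
  ≡⟨ sym (*-assoc m _ R) ⟩
    m * (X ∸ Y) * R
  ≡⟨ cong (_* R) (*-distribˡ-∸ m X Y) ⟩
    (m * X ∸ m * Y) * R
  ≤⟨ *-monoˡ-≤ R (m≤n+o⇒m∸n≤o (m * X) (m * Y) key) ⟩
    a * suc b * X * R
  ≡⟨ *-assoc (a * suc b) X R ⟩
    a * suc b * (X * R) ∎
  where
  open ≤-Reasoning
  X = falling m (suc b)
  Y = falling (m ∸ a) (suc b)
  key : m * X ≤ m * Y + a * suc b * X
  key = begin
      m * X
    ≤⟨ *-monoʳ-≤ m (falling-∸-diff m a b) ⟩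
      m * (Y + a * suc b * falling (m ∸ 1) b)
    ≡⟨ *-distribˡ-+ m Y _ ⟩
      m * Y + m * (a * suc b * falling (m ∸ 1) b)
    ≡⟨ cong (m * Y +_) (lem m (a * suc b) (falling (m ∸ 1) b)) ⟩
      m * Y + a * suc b * X ∎
    where
    lem : ∀ m c f → m * (c * f) ≡ c * (m * f)
    lem = solve-∀

prefix : ∀ {A : Set} {k} → ℕ → Vec A k → List A
prefix zero v = []
prefix (suc b) [] = []
prefix (suc b) (x ∷ v) = x ∷ prefix b v

𝟙-not-∨-∧ : ∀ a b c → 𝟙 (not (a ∨ b) ∧ c) ≡ 𝟙 (not a) * 𝟙 (not b ∧ c)
𝟙-not-∨-∧ true b c = refl
𝟙-not-∨-∧ false b c = sym (+-identityʳ _)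

𝟙-∧-not-∨ : ∀ a b c e → 𝟙 ((a ∧ b) ∧ not (c ∨ e)) ≡ 𝟙 (not c) * 𝟙 (a ∧ (b ∧ not e))
𝟙-∧-not-∨ true true true e = refl
𝟙-∧-not-∨ true true false e = sym (+-identityʳ _)
𝟙-∧-not-∨ true false true e = refl
𝟙-∧-not-∨ true false false e = refl
𝟙-∧-not-∨ false b true e = refl
𝟙-∧-not-∨ false b false e = refl

module _ {m : ℕ} where
  distinct : ∀ {k} → Vec (Fin m) k → Bool
  distinct v = distinctL (toList v)

  remove : Fin m → List (Fin m) → List (Fin m)
  remove y xs = filter (λ z → T? (not (y == z))) xs

  countᵇ-vecsOf-remove : ∀ k (y : Fin m) (g : Vec (Fin m) k → Bool) (xs : List (Fin m)) →
        countᵇ (λ v → not (any (y ==_) (toList v)) ∧ g v) (vecsOf xs k) ≡ countᵇ g (vecsOf (remove y xs) k)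
  countᵇ-vecsOf-remove zero y g xs = refl
  countᵇ-vecsOf-remove (suc k) y g xs = begin
      countᵇ (λ v → not (any (y ==_) (toList v)) ∧ g v) (vecsOf xs (suc k))
    ≡⟨ ∑-vecsOf-suc xs k _ ⟩
      ∑ (λ z → ∑ (λ v → 𝟙 (not ((y == z) ∨ any (y ==_) (toList v)) ∧ g (z ∷ v))) (vecsOf xs k)) xs
    ≡⟨ ∑-cong xs (λ z _ → ∑-cong (vecsOf xs k) (λ v _ → 𝟙-not-∨-∧ (y == z) _ _)) ⟩
      ∑ (λ z → ∑ (λ v → 𝟙 (not (y == z)) * 𝟙 (not (any (y ==_) (toList v)) ∧ g (z ∷ v))) (vecsOf xs k)) xs
    ≡⟨ ∑-cong xs (λ z _ → ∑-*ˡ (𝟙 (not (y == z))) (λ v → 𝟙 (not (any (y ==_) (toList v)) ∧ g (z ∷ v))) (vecsOf xs k)) ⟩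
      ∑ (λ z → 𝟙 (not (y == z)) * countᵇ (λ v → not (any (y ==_) (toList v)) ∧ g (z ∷ v)) (vecsOf xs k)) xs
    ≡⟨ ∑-cong xs (λ z _ → cong (𝟙 (not (y == z)) *_) (countᵇ-vecsOf-remove k y (λ v → g (z ∷ v)) xs)) ⟩
      ∑ (λ z → 𝟙 (not (y == z)) * countᵇ (λ v → g (z ∷ v)) (vecsOf (remove y xs) k)) xs
    ≡⟨ sym (∑-filter (λ z → not (y == z)) (λ z → countᵇ (λ v → g (z ∷ v)) (vecsOf (remove y xs) k)) xs) ⟩
      ∑ (λ z → countᵇ (λ v → g (z ∷ v)) (vecsOf (remove y xs) k)) (remove y xs)
    ≡⟨ sym (∑-vecsOf-suc (remove y xs) k _) ⟩
      countᵇ g (vecsOf (remove y xs) (suc k)) ∎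
    where open ≡-Reasoning

  length-remove : (y : Fin m) (xs : List (Fin m)) → Unique xs → y ∈ xs → length (remove y xs) ≡ length xs ∸ 1
  length-remove y xs u y∈ = begin
      length (remove y xs)
    ≡⟨ length-filter (λ z → not (y == z)) xs ⟩
      countᵇ (λ z → not (y == z)) xs
    ≡⟨ sym (m+n∸n≡m _ 1) ⟩
      countᵇ (λ z → not (y == z)) xs + 1 ∸ 1
    ≡⟨ cong (λ w → countᵇ (λ z → not (y == z)) xs + w ∸ 1) (sym (trans (∑-cong xs (λ z _ → cong 𝟙 (==-sym y z))) (countᵇ-==≡1 xs u y∈))) ⟩
      countᵇ (λ z → not (y == z)) xs + countᵇ (y ==_) xs ∸ 1
    ≡⟨ cong (_∸ 1) (countᵇ-not+countᵇ (y ==_) xs) ⟩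
      length xs ∸ 1 ∎
    where open ≡-Reasoning

  All-remove : (y : Fin m) (xs Sl : List (Fin m)) → LA.All (_∈ xs) Sl → T (not (any (y ==_) Sl)) → LA.All (_∈ remove y xs) Sl
  All-remove y xs Sl al ny = LA.tabulate (λ {z} z∈ → ∈-filter⁺ (λ z → T? (not (y == z))) (LA.lookup al z∈)
                           (T-not (λ e → T-not⁻ ny (any-intro (y ==_) z∈ e))))

  -- Choose the b prefix entries outside Sl one by one, then the remaining k ∸ b entries
  -- among the N ∸ b unused elements.
  countᵇ-distinct-avoiding : ∀ k b (xs Sl : List (Fin m)) → b ≤ k → Unique xs → Unique Sl → LA.All (_∈ xs) Sl →
    countᵇ (λ v → distinct v ∧ not (intersects (prefix b v) Sl)) (vecsOf xs k) ≡ falling (length xs ∸ length Sl) b * falling (length xs ∸ b) (k ∸ b)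
  countᵇ-distinct-avoiding zero zero xs Sl b≤k uxs uSl al = refl
  countᵇ-distinct-avoiding (suc k) zero xs Sl b≤k uxs uSl al = begin
      countᵇ (λ v → distinct v ∧ true) (vecsOf xs (suc k))
    ≡⟨ ∑-vecsOf-suc xs k _ ⟩
      ∑ (λ y → ∑ (λ v → 𝟙 ((not (any (y ==_) (toList v)) ∧ distinct v) ∧ true)) (vecsOf xs k)) xs
    ≡⟨ ∑-cong xs (λ y _ → ∑-cong (vecsOf xs k) (λ v _ → cong 𝟙 (∧-assoc (not (any (y ==_) (toList v))) (distinct v) true))) ⟩
      ∑ (λ y → countᵇ (λ v → not (any (y ==_) (toList v)) ∧ (distinct v ∧ true)) (vecsOf xs k)) xs
    ≡⟨ ∑-cong xs (λ y _ → countᵇ-vecsOf-remove k y (λ v → distinct v ∧ true) xs) ⟩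
      ∑ (λ y → countᵇ (λ v → distinct v ∧ true) (vecsOf (remove y xs) k)) xs
    ≡⟨ ∑-cong xs (λ y y∈ → trans (countᵇ-distinct-avoiding k zero (remove y xs) [] z≤n (UP.filter⁺ (λ z → T? (not (y == z))) uxs) AP.[] [])
                                 (trans (+-identityʳ _) (cong (λ w → falling w k) (length-remove y xs uxs y∈)))) ⟩
      ∑ (λ y → falling (length xs ∸ 1) k) xs
    ≡⟨ ∑-const _ xs ⟩
      falling (length xs ∸ 1) k * length xs
    ≡⟨ *-comm (falling (length xs ∸ 1) k) (length xs) ⟩
      length xs * falling (length xs ∸ 1) k
    ≡⟨ sym (+-identityʳ _) ⟩
      falling (length xs ∸ length Sl) zero * falling (length xs ∸ zero) (suc k ∸ zero) ∎
    where open ≡-Reasoning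
  countᵇ-distinct-avoiding (suc k) (suc b) xs Sl (s≤s b≤k) uxs uSl al = begin
      countᵇ (λ v → distinct v ∧ not (intersects (prefix (suc b) v) Sl)) (vecsOf xs (suc k))
    ≡⟨ ∑-vecsOf-suc xs k _ ⟩
      ∑ (λ y → ∑ (λ v → 𝟙 ((not (any (y ==_) (toList v)) ∧ distinct v) ∧ not (any (y ==_) Sl ∨ intersects (prefix b v) Sl))) (vecsOf xs k)) xs
    ≡⟨ ∑-cong xs (λ y _ → ∑-cong (vecsOf xs k) (λ v _ → 𝟙-∧-not-∨ (not (any (y ==_) (toList v))) (distinct v) (any (y ==_) Sl) (intersects (prefix b v) Sl))) ⟩
      ∑ (λ y → ∑ (λ v → 𝟙 (not (any (y ==_) Sl)) * 𝟙 (not (any (y ==_) (toList v)) ∧ (distinct v ∧ not (intersects (prefix b v) Sl)))) (vecsOf xs k)) xs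
    ≡⟨ ∑-cong xs (λ y _ → ∑-*ˡ (𝟙 (not (any (y ==_) Sl))) (λ v → 𝟙 (not (any (y ==_) (toList v)) ∧ (distinct v ∧ not (intersects (prefix b v) Sl)))) (vecsOf xs k)) ⟩
      ∑ (λ y → 𝟙 (not (any (y ==_) Sl)) * countᵇ (λ v → not (any (y ==_) (toList v)) ∧ (distinct v ∧ not (intersects (prefix b v) Sl))) (vecsOf xs k)) xs
    ≡⟨ ∑-cong xs (λ y _ → cong (𝟙 (not (any (y ==_) Sl)) *_) (countᵇ-vecsOf-remove k y (λ v → distinct v ∧ not (intersects (prefix b v) Sl)) xs)) ⟩
      ∑ (λ y → 𝟙 (not (any (y ==_) Sl)) * countᵇ (λ v → distinct v ∧ not (intersects (prefix b v) Sl)) (vecsOf (remove y xs) k)) xs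
    ≡⟨ ∑-cong xs step ⟩
      ∑ (λ y → 𝟙 (not (any (y ==_) Sl)) * C) xs
    ≡⟨ ∑-*ʳ C _ xs ⟩
      countᵇ (λ y → not (any (y ==_) Sl)) xs * C
    ≡⟨ cong (_* C) (countᵇ-not-any-== xs Sl uxs uSl al) ⟩
      (N ∸ length Sl) * C
    ≡⟨ sym (*-assoc (N ∸ length Sl) _ _) ⟩
      (N ∸ length Sl) * falling (N ∸ length Sl ∸ 1) b * falling (N ∸ suc b) (k ∸ b) ∎
    where
    open ≡-Reasoning
    N = length xs
    C = falling (N ∸ length Sl ∸ 1) b * falling (N ∸ suc b) (k ∸ b)
    step : ∀ y → y ∈ xs → 𝟙 (not (any (y ==_) Sl)) * countᵇ (λ v → distinct v ∧ not (intersects (prefix b v) Sl)) (vecsOf (remove y xs) k)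
                          ≡ 𝟙 (not (any (y ==_) Sl)) * C
    step y y∈ with not (any (y ==_) Sl) in eq
    ... | false = refl
    ... | true = cong (1 *_) (begin
          countᵇ (λ v → distinct v ∧ not (intersects (prefix b v) Sl)) (vecsOf (remove y xs) k)
        ≡⟨ countᵇ-distinct-avoiding k b (remove y xs) Sl b≤k (UP.filter⁺ (λ z → T? (not (y == z))) uxs) uSl (All-remove y xs Sl al (subst T (sym eq) tt)) ⟩
          falling (length (remove y xs) ∸ length Sl) b * falling (length (remove y xs) ∸ b) (k ∸ b)
        ≡⟨ cong (λ w → falling (w ∸ length Sl) b * falling (w ∸ b) (k ∸ b)) (length-remove y xs uxs y∈) ⟩
          falling (N ∸ 1 ∸ length Sl) b * falling (N ∸ 1 ∸ b) (k ∸ b)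
        ≡⟨ cong₂ (λ u w → falling u b * falling w (k ∸ b)) (trans (∸-+-assoc N 1 (length Sl)) (sym (trans (∸-+-assoc N (length Sl) 1) (cong (N ∸_) (+-comm (length Sl) 1))))) (∸-+-assoc N 1 b) ⟩
          C ∎)

  ∈-prefix⁻ : ∀ {k} (b : ℕ) (v : Vec (Fin m) k) {x : Fin m} → x ∈ prefix b v → ∃[ t ] (toℕ t < b × lookup v t ≡ x)
  ∈-prefix⁻ (suc b) (y ∷ v) (here refl) = fz , s≤s z≤n , refl
  ∈-prefix⁻ (suc b) (y ∷ v) (there p) with ∈-prefix⁻ b v p
  ... | t , lt , e = fs t , s≤s lt , e

  ∈-prefix⁺ : ∀ {k} (b : ℕ) (v : Vec (Fin m) k) (t : Fin k) → toℕ t < b → lookup v t ∈ prefix b v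
  ∈-prefix⁺ (suc b) (y ∷ v) fz lt = here refl
  ∈-prefix⁺ (suc b) (y ∷ v) (fs t) (s≤s lt) = there (∈-prefix⁺ b v t lt)

  intersects-⊆ : (L L' M : List (Fin m)) → (∀ {x} → x ∈ L → x ∈ L') → T (intersects L M) → T (intersects L' M)
  intersects-⊆ L L' M sub p with intersects-elim L M p
  ... | x , xL , xM = intersects-intro (sub xL) xM

  intersects-comm : (L M : List (Fin m)) → intersects L M ≡ intersects M L
  intersects-comm L M = T-ext (λ p → let (x , a , b) = intersects-elim L M p in intersects-intro b a)
                        (λ p → let (x , a , b) = intersects-elim M L p in intersects-intro b a)

  intersects-outputs≡prefix : (v : Perm m) (d : ℕ) (Sl : List (Fin m)) → intersects (outputs v d) Sl ≡ intersects (prefix d v) Sl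
  intersects-outputs≡prefix v d Sl = T-ext (intersects-⊆ (outputs v d) (prefix d v) Sl (λ p → let (t , lt , e) = ∈-outputs⁻ {σ = v} p in subst (_∈ prefix d v) e (∈-prefix⁺ d v t lt)))
                         (intersects-⊆ (prefix d v) (outputs v d) Sl (λ p → let (t , lt , e) = ∈-prefix⁻ d v p in subst (_∈ outputs v d) e (∈-outputs⁺ {σ = v} t lt)))

  countᵇ-allPerms : (f : Perm m → Bool) → countᵇ f (allPerms m) ≡ countᵇ (λ v → distinct v ∧ f v) (vecsOf (allFin m) m)
  countᵇ-allPerms f = trans (∑-filter distinct (λ v → 𝟙 (f v)) (vecsOf (allFin m) m))
                         (∑-cong (vecsOf (allFin m) m) (λ v _ → sym (𝟙-∧ (distinct v) (f v))))

  random-avoid-count : (Sl : List (Fin m)) → Unique Sl → (d : ℕ) → d ≤ m →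
     countᵇ (λ σ → not (intersects (outputs σ d) Sl)) (allPerms m) ≡ falling (m ∸ length Sl) d * falling (m ∸ d) (m ∸ d)
  random-avoid-count Sl uSl d d≤m = begin
      countᵇ (λ σ → not (intersects (outputs σ d) Sl)) (allPerms m)
    ≡⟨ countᵇ-allPerms _ ⟩
      countᵇ (λ v → distinct v ∧ not (intersects (outputs v d) Sl)) (vecsOf (allFin m) m)
    ≡⟨ ∑-cong (vecsOf (allFin m) m) (λ v _ → cong (λ z → 𝟙 (distinct v ∧ not z)) (intersects-outputs≡prefix v d Sl)) ⟩
      countᵇ (λ v → distinct v ∧ not (intersects (prefix d v) Sl)) (vecsOf (allFin m) m)
    ≡⟨ countᵇ-distinct-avoiding m d (allFin m) Sl d≤m (UP.allFin⁺ m) uSl (LA.tabulate (λ {z} _ → ∈-allFin z)) ⟩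
      falling (length (allFin m) ∸ length Sl) d * falling (length (allFin m) ∸ d) (m ∸ d)
    ≡⟨ cong (λ w → falling (w ∸ length Sl) d * falling (w ∸ d) (m ∸ d)) (length-allFin m) ⟩
      falling (m ∸ length Sl) d * falling (m ∸ d) (m ∸ d) ∎
    where open ≡-Reasoning

  length-allPerms : length (allPerms m) ≡ falling m m
  length-allPerms = begin
      length (allPerms m)
    ≡⟨ length-filter distinct (vecsOf (allFin m) m) ⟩
      countᵇ distinct (vecsOf (allFin m) m)
    ≡⟨ ∑-cong (vecsOf (allFin m) m) (λ v _ → cong 𝟙 (sym (∧-identityʳ (distinct v)))) ⟩
      countᵇ (λ v → distinct v ∧ not (intersects (prefix 0 v) [])) (vecsOf (allFin m) m)
    ≡⟨ countᵇ-distinct-avoiding m 0 (allFin m) [] z≤n (UP.allFin⁺ m) AP.[] [] ⟩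
      falling (length (allFin m) ∸ 0) 0 * falling (length (allFin m) ∸ 0) (m ∸ 0)
    ≡⟨ trans (+-identityʳ _) (cong (λ w → falling w m) (length-allFin m)) ⟩
      falling m m ∎
    where open ≡-Reasoning

  length-allPerms-split : ∀ d → d ≤ m → length (allPerms m) ≡ falling m d * falling (m ∸ d) (m ∸ d)
  length-allPerms-split d d≤m = trans (trans length-allPerms (cong (falling m) (sym (m+[n∸m]≡n d≤m)))) (falling-+ m d (m ∸ d))

  ∈-toList : ∀ {k} (v : Vec (Fin m) k) (t : Fin k) → lookup v t ∈ toList v
  ∈-toList (x ∷ v) fz = here refl
  ∈-toList (x ∷ v) (fs t) = there (∈-toList v t)

  distinct-injective : ∀ {k} (v : Vec (Fin m) k) → T (distinct v) → ∀ {s t} → lookup v s ≡ lookup v t → s ≡ t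
  distinct-injective (x ∷ v) p {fz} {fz} e = refl
  distinct-injective (x ∷ v) p {fz} {fs t} e = ⊥-elim (T-not⁻ (proj₁ (to T-∧ p)) (any-intro (x ==_) (∈-toList v t) (≡→== e)))
  distinct-injective (x ∷ v) p {fs s} {fz} e = ⊥-elim (T-not⁻ (proj₁ (to T-∧ p)) (any-intro (x ==_) (∈-toList v s) (≡→== (sym e))))
  distinct-injective (x ∷ v) p {fs s} {fs t} e = cong fs (distinct-injective v (proj₂ (to (T-∧ {not (any (x ==_) (toList v))}) p)) e)

  random-injective : ∀ σ → σ ∈ allPerms m → ∀ {s t} → lookup σ s ≡ lookup σ t → s ≡ t
  random-injective σ σ∈ = distinct-injective σ (proj₂ (∈-filter⁻ (λ v → T? (distinct v)) {xs = vecsOf (allFin m) m} σ∈))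

  random-avoid-bound : ∀ d → 1 ≤ d → d ≤ m → (Sl : List (Fin m)) → Unique Sl →
      m ^ d * countᵇ (λ σ → not (intersects (outputs σ d) Sl)) (allPerms m) ≤ length (allPerms m) * (m ∸ length Sl) ^ d
  random-avoid-bound d _ d≤m Sl uSl = begin
      m ^ d * countᵇ (λ σ → not (intersects (outputs σ d) Sl)) (allPerms m)
    ≡⟨ cong (m ^ d *_) (random-avoid-count Sl uSl d d≤m) ⟩
      m ^ d * (falling (m ∸ length Sl) d * R)
    ≡⟨ sym (*-assoc (m ^ d) _ R) ⟩
      m ^ d * falling (m ∸ length Sl) d * R
    ≤⟨ *-monoˡ-≤ R (^*falling≤falling*^ m (length Sl) d) ⟩
      falling m d * (m ∸ length Sl) ^ d * R
    ≡⟨ lem (falling m d) ((m ∸ length Sl) ^ d) R ⟩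
      falling m d * R * (m ∸ length Sl) ^ d
    ≡⟨ cong (_* (m ∸ length Sl) ^ d) (sym (length-allPerms-split d d≤m)) ⟩
      length (allPerms m) * (m ∸ length Sl) ^ d ∎
    where
    open ≤-Reasoning
    R = falling (m ∸ d) (m ∸ d)
    lem : ∀ a b c → a * b * c ≡ a * c * b
    lem = solve-∀

  random-pair-bound : (σ : Perm m) → σ ∈ allPerms m → (a b : ℕ) → a ≤ m → b ≤ m →
      m * countᵇ (λ τ → intersects (outputs σ a) (outputs τ b)) (allPerms m) ≤ a * b * length (allPerms m)
  random-pair-bound σ σ∈ a b a≤m b≤m = begin
      m * countᵇ (λ τ → intersects (outputs σ a) (outputs τ b)) (allPerms m)
    ≡⟨ cong (m *_) (∑-cong (allPerms m) (λ τ _ → cong 𝟙 (intersects-comm (outputs σ a) (outputs τ b)))) ⟩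
      m * countᵇ (λ τ → intersects (outputs τ b) Sl) (allPerms m)
    ≡⟨ cong (m *_) (countᵇ≡length∸countᵇ-not (λ τ → intersects (outputs τ b) Sl) (allPerms m)) ⟩
      m * (length (allPerms m) ∸ countᵇ (λ τ → not (intersects (outputs τ b) Sl)) (allPerms m))
    ≡⟨ cong₂ (λ u w → m * (u ∸ w)) all≡ (trans (random-avoid-count Sl Sl-unique b b≤m) (cong (λ w → falling (m ∸ w) b * R) (length-outputs σ a a≤m))) ⟩
      m * (falling m b * R ∸ falling (m ∸ a) b * R)
    ≤⟨ hit-bound m a b R ⟩
      a * b * (falling m b * R)
    ≡⟨ cong (a * b *_) (sym all≡) ⟩
      a * b * length (allPerms m) ∎
    where
    open ≤-Reasoning
    Sl = outputs σ a
    Sl-unique = outputs-unique σ a (random-injective σ σ∈)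
    R = falling (m ∸ b) (m ∸ b)
    all≡ : length (allPerms m) ≡ falling m b * R
    all≡ = length-allPerms-split b b≤m

module _ (k : ℕ) where
  private
    m = suc k

  %-cong-+ʳ : ∀ p q c → p % m ≡ q % m → (p + c) % m ≡ (q + c) % m
  %-cong-+ʳ p q c e = begin
      (p + c) % m
    ≡⟨ %-distribˡ-+ p c m ⟩
      (p % m + c % m) % m
    ≡⟨ cong (λ z → (z + c % m) % m) e ⟩
      (q % m + c % m) % m
    ≡⟨ sym (%-distribˡ-+ q c m) ⟩
      (q + c) % m ∎
    where open ≡-Reasoning

  %-+-%ʳ : ∀ v c → (v + c) % m ≡ (v + c % m) % m
  %-+-%ʳ v c = begin
      (v + c) % m
    ≡⟨ %-distribˡ-+ v c m ⟩
      (v % m + c % m) % m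
    ≡⟨ cong (λ z → (v % m + z) % m) (sym (m%n%n≡m%n c m)) ⟩
      (v % m + c % m % m) % m
    ≡⟨ sym (%-distribˡ-+ v (c % m) m) ⟩
      (v + c % m) % m ∎
    where open ≡-Reasoning

  +-%-cancelʳ : ∀ u u' c → u < m → u' < m → (u + c) % m ≡ (u' + c) % m → u ≡ u'
  +-%-cancelʳ u u' c u<m u'<m eq = trans (sym (unshift u u<m)) (trans (%-cong-+ʳ (u + c) (u' + c) (m ∸ c % m) eq) (unshift u' u'<m))
    where
    unshift : ∀ v → v < m → (v + c + (m ∸ c % m)) % m ≡ v
    unshift v v<m = begin
        (v + c + (m ∸ c % m)) % m
      ≡⟨ %-cong-+ʳ (v + c) (v + c % m) (m ∸ c % m) (%-+-%ʳ v c) ⟩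
        (v + c % m + (m ∸ c % m)) % m
      ≡⟨ cong (_% m) (trans (+-assoc v (c % m) _) (cong (v +_) (m+[n∸m]≡n (<⇒≤ (m%n<n c m))))) ⟩
        (v + m) % m
      ≡⟨ [m+n]%n≡m%n v m ⟩
        v % m
      ≡⟨ m<n⇒m%n≡m v<m ⟩
        v ∎
      where open ≡-Reasoning

  residue : ℕ → Fin m
  residue n = fromℕ< (m%n<n n m)

  toℕ-residue : ∀ n → toℕ (residue n) ≡ n % m
  toℕ-residue n = toℕ-fromℕ< (m%n<n n m)

  rotation : Fin m → Perm m
  rotation x = Vec.tabulate (λ t → residue (toℕ x + toℕ t))

  toℕ-rotation : ∀ x t → toℕ (lookup (rotation x) t) ≡ (toℕ x + toℕ t) % m
  toℕ-rotation x t = trans (cong toℕ (lookup∘tabulate (λ t → residue (toℕ x + toℕ t)) t)) (toℕ-residue (toℕ x + toℕ t))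

  rotation-injective : ∀ x {s t} → lookup (rotation x) s ≡ lookup (rotation x) t → s ≡ t
  rotation-injective x {s} {t} e = toℕ-injective (+-%-cancelʳ (toℕ s) (toℕ t) (toℕ x) (toℕ<n s) (toℕ<n t)
      (trans (cong (_% m) (+-comm (toℕ s) (toℕ x))) (trans (sym (toℕ-rotation x s)) (trans (cong toℕ e) (trans (toℕ-rotation x t) (cong (_% m) (+-comm (toℕ x) (toℕ t))))))))

  cluster-injective : ∀ σ → σ ∈ cluster m → ∀ {s t} → lookup σ s ≡ lookup σ t → s ≡ t
  cluster-injective σ σ∈ with ∈-map⁻ rotation {xs = allFin m} σ∈
  ... | x , _ , refl = rotation-injective x

  length-cluster : length (cluster m) ≡ m
  length-cluster = trans (length-map rotation (allFin m)) (length-allFin m)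

  rotation-head : ∀ x → lookup (rotation x) fz ≡ x
  rotation-head x = toℕ-injective (trans (toℕ-rotation x fz) (trans (cong (_% m) (+-identityʳ (toℕ x))) (m<n⇒m%n≡m (toℕ<n x))))

  cluster-avoid-bound : ∀ d → 1 ≤ d → d ≤ m → (Sl : List (Fin m)) → Unique Sl →
      m ^ 1 * countᵇ (λ σ → not (intersects (outputs σ d) Sl)) (cluster m) ≤ length (cluster m) * (m ∸ length Sl)
  cluster-avoid-bound d 1≤d d≤m Sl uSl = begin
      m ^ 1 * countᵇ (λ σ → not (intersects (outputs σ d) Sl)) (cluster m)
    ≡⟨ cong₂ _*_ (*-identityʳ m) (∑-map (λ σ → 𝟙 (not (intersects (outputs σ d) Sl))) rotation (allFin m)) ⟩
      m * countᵇ (λ x → not (intersects (outputs (rotation x) d) Sl)) (allFin m)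
    ≤⟨ *-monoʳ-≤ m (countᵇ-mono (allFin m) (λ x _ p → T-not (λ q → T-not⁻ p (intersects-intro (subst (_∈ outputs (rotation x) d) (rotation-head x) (∈-outputs⁺ {σ = rotation x} fz 1≤d)) (proj₂ (proj₂ (any-elim' x q))))))) ⟩
      m * countᵇ (λ x → not (any (x ==_) Sl)) (allFin m)
    ≡⟨ cong (m *_) (countᵇ-not-any-== (allFin m) Sl (UP.allFin⁺ m) uSl (LA.tabulate (λ {z} _ → ∈-allFin z))) ⟩
      m * (length (allFin m) ∸ length Sl)
    ≡⟨ cong (λ w → m * (w ∸ length Sl)) (length-allFin m) ⟩
      m * (m ∸ length Sl)
    ≡⟨ cong (_* (m ∸ length Sl)) (sym length-cluster) ⟩
      length (cluster m) * (m ∸ length Sl) ∎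
    where
    open ≤-Reasoning
    any-elim' : ∀ x → T (any (x ==_) Sl) → ∃[ y ] (y ∈ Sl × x ∈ Sl)
    any-elim' x q with any-elim (x ==_) Sl q
    ... | y , y∈ , e = y , y∈ , subst (_∈ Sl) (sym (==→≡ {x = x} e)) y∈

  window : Fin m → ℕ → List (Fin m)
  window x l = map (λ r → residue (toℕ x + r)) (upTo l)

  rotations-meet⇒end∈window : ∀ x y a b → T (intersects (outputs (rotation x) a) (outputs (rotation y) b)) →
    residue (toℕ y + (b ∸ 1)) ∈ window x (a + b)
  rotations-meet⇒end∈window x y a b meet with intersects-elim (outputs (rotation x) a) (outputs (rotation y) b) meet
  ... | z , z∈x , z∈y with ∈-outputs⁻ {σ = rotation x} {d = a} z∈x | ∈-outputs⁻ {σ = rotation y} {d = b} z∈y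
  ... | s , s<a , xs≡z | t , t<b , yt≡z =
    subst (_∈ window x (a + b)) (sym end≡) (∈-map⁺ (λ r → residue (toℕ x + r)) {xs = upTo (a + b)} (∈-upTo⁺ s+c<a+b))
    where
    c = b ∸ 1 ∸ toℕ t
    t+c≡b-1 : toℕ t + c ≡ b ∸ 1
    t+c≡b-1 = m+[n∸m]≡n (∸-monoˡ-≤ 1 t<b)
    s+c<a+b : toℕ s + c < a + b
    s+c<a+b = +-mono-<-≤ s<a (≤-trans (m∸n≤m (b ∸ 1) (toℕ t)) (m∸n≤m b 1))
    x+s≡y+t : (toℕ x + toℕ s) % m ≡ (toℕ y + toℕ t) % m
    x+s≡y+t = trans (sym (toℕ-rotation x s)) (trans (cong toℕ (trans xs≡z (sym yt≡z))) (toℕ-rotation y t))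
    end≡ : residue (toℕ y + (b ∸ 1)) ≡ residue (toℕ x + (toℕ s + c))
    end≡ = toℕ-injective (begin
        toℕ (residue (toℕ y + (b ∸ 1)))
      ≡⟨ toℕ-residue (toℕ y + (b ∸ 1)) ⟩
        (toℕ y + (b ∸ 1)) % m
      ≡⟨ cong (λ w → (toℕ y + w) % m) (sym t+c≡b-1) ⟩
        (toℕ y + (toℕ t + c)) % m
      ≡⟨ cong (_% m) (sym (+-assoc (toℕ y) (toℕ t) c)) ⟩
        (toℕ y + toℕ t + c) % m
      ≡⟨ %-cong-+ʳ (toℕ y + toℕ t) (toℕ x + toℕ s) c (sym x+s≡y+t) ⟩
        (toℕ x + toℕ s + c) % m
      ≡⟨ cong (_% m) (+-assoc (toℕ x) (toℕ s) c) ⟩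
        (toℕ x + (toℕ s + c)) % m
      ≡⟨ sym (toℕ-residue (toℕ x + (toℕ s + c))) ⟩
        toℕ (residue (toℕ x + (toℕ s + c))) ∎)
      where open ≡-Reasoning

  cluster-pair-bound : (σ : Perm m) → σ ∈ cluster m → (a b : ℕ) →
      countᵇ (λ τ → intersects (outputs σ a) (outputs τ b)) (cluster m) ≤ a + b
  cluster-pair-bound σ σ∈ a b with ∈-map⁻ rotation {xs = allFin m} σ∈
  ... | x , _ , refl = begin
      countᵇ (λ τ → intersects (outputs (rotation x) a) (outputs τ b)) (cluster m)
    ≡⟨ ∑-map (λ τ → 𝟙 (intersects (outputs (rotation x) a) (outputs τ b))) rotation (allFin m) ⟩
      countᵇ (λ y → intersects (outputs (rotation x) a) (outputs (rotation y) b)) (allFin m)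
    ≤⟨ countᵇ-inj≤length _ end end-injective (allFin m) (UP.allFin⁺ m) (window x (a + b)) (λ y → rotations-meet⇒end∈window x y a b) ⟩
      length (window x (a + b))
    ≡⟨ trans (length-map (λ r → residue (toℕ x + r)) (upTo (a + b))) (length-upTo (a + b)) ⟩
      a + b ∎
    where
    open ≤-Reasoning
    end : Fin m → Fin m
    end y = residue (toℕ y + (b ∸ 1))
    end-injective : ∀ {y y'} → end y ≡ end y' → y ≡ y'
    end-injective {y} {y'} e = toℕ-injective (+-%-cancelʳ (toℕ y) (toℕ y') (b ∸ 1) (toℕ<n y) (toℕ<n y')
      (trans (sym (toℕ-residue (toℕ y + (b ∸ 1)))) (trans (cong toℕ e) (toℕ-residue (toℕ y' + (b ∸ 1))))))

frac-suc-≃ : ∀ a b → toℚᵘ (frac a (suc b)) ℚᵘ.≃ mkℚᵘ (ℤ.+ a) b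
frac-suc-≃ a b = ℚP.toℚᵘ-fromℚᵘ (mkℚᵘ (ℤ.+ a) b)

frac*frac-≃ : ∀ u v a b → toℚᵘ (frac u (suc v) ℚ.* frac a (suc b)) ℚᵘ.≃ mkℚᵘ (ℤ.+ u) v ℚᵘ.* mkℚᵘ (ℤ.+ a) b
frac*frac-≃ u v a b = ℚᵘP.≃-trans (ℚP.toℚᵘ-homo-* (frac u (suc v)) (frac a (suc b))) (ℚᵘP.*-cong (frac-suc-≃ u v) (frac-suc-≃ a b))

frac*frac≤frac : ∀ u v a b c e → u * a * suc e ≤ c * (suc v * suc b) →
                 frac u (suc v) ℚ.* frac a (suc b) ℚ.≤ frac c (suc e)
frac*frac≤frac u v a b c e le = ℚP.toℚᵘ-cancel-≤
   (ℚᵘP.≤-respˡ-≃ (ℚᵘP.≃-sym (frac*frac-≃ u v a b)) (ℚᵘP.≤-respʳ-≃ (ℚᵘP.≃-sym (frac-suc-≃ c e)) (*≤* ℤ-le)))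
  where
  ℤ-le : (ℤ.+ u ℤ.* ℤ.+ a) ℤ.* ℤ.+ suc e ℤ.≤ ℤ.+ c ℤ.* ℤ.+ (suc v * suc b)
  ℤ-le = subst₂ ℤ._≤_ (trans (ℤP.pos-* (u * a) (suc e)) (cong (ℤ._* ℤ.+ suc e) (ℤP.pos-* u a))) (ℤP.pos-* c (suc v * suc b)) (+≤+ le)

frac≤frac*frac : ∀ u v a b c e → c * (suc v * suc b) ≤ u * a * suc e →
                 frac c (suc e) ℚ.≤ frac u (suc v) ℚ.* frac a (suc b)
frac≤frac*frac u v a b c e le = ℚP.toℚᵘ-cancel-≤
   (ℚᵘP.≤-respʳ-≃ (ℚᵘP.≃-sym (frac*frac-≃ u v a b)) (ℚᵘP.≤-respˡ-≃ (ℚᵘP.≃-sym (frac-suc-≃ c e)) (*≤* ℤ-le)))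
  where
  ℤ-le : ℤ.+ c ℤ.* ℤ.+ (suc v * suc b) ℤ.≤ (ℤ.+ u ℤ.* ℤ.+ a) ℤ.* ℤ.+ suc e
  ℤ-le = subst₂ ℤ._≤_ (ℤP.pos-* c (suc v * suc b)) (trans (ℤP.pos-* (u * a) (suc e)) (cong (ℤ._* ℤ.+ suc e) (ℤP.pos-* u a))) (+≤+ le)

frac≤2*[1⊓frac] : ∀ c L X m → c ≤ L → m * c ≤ 2 * X * L → 1 ≤ L → 1 ≤ m →
                  frac c L ℚ.≤ frac 2 1 ℚ.* (1ℚ ⊓ frac X m)
frac≤2*[1⊓frac] c (suc L) X (suc m) c≤L mc≤2XL _ _ with ℚP.⊓-sel 1ℚ (frac X (suc m))
... | inj₁ e rewrite e = frac≤frac*frac 2 0 1 0 c L (≤-trans (≤-reflexive (*-identityʳ c)) (≤-trans c≤L (m≤m+n (suc L) _)))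
... | inj₂ e rewrite e = frac≤frac*frac 2 0 X m c L (≤-trans (≤-reflexive (trans (cong (c *_) (*-identityˡ (suc m))) (*-comm c (suc m)))) mc≤2XL)

frac*[1⊓frac]≤frac : ∀ K c L X m → (L ≤ K * c ⊎ X * L ≤ c * (K * m)) → 1 ≤ K → 1 ≤ L → 1 ≤ m →
                     frac 1 K ℚ.* (1ℚ ⊓ frac X m) ℚ.≤ frac c L
frac*[1⊓frac]≤frac (suc K) c (suc L) X (suc m) (inj₁ L≤Kc) _ _ _ =
  ℚP.≤-trans (ℚP.*-monoˡ-≤-nonNeg (frac 1 (suc K)) {{ℚP.normalize-nonNeg 1 (suc K)}} (ℚP.p⊓q≤p 1ℚ (frac X (suc m))))
    (frac*frac≤frac 1 K 1 0 c L (≤-trans (≤-reflexive (+-identityʳ (suc L))) (≤-trans L≤Kc (≤-reflexive (trans (*-comm (suc K) c) (cong (c *_) (sym (*-identityʳ (suc K)))))))))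
frac*[1⊓frac]≤frac (suc K) c (suc L) X (suc m) (inj₂ XL≤cKm) _ _ _ =
  ℚP.≤-trans (ℚP.*-monoˡ-≤-nonNeg (frac 1 (suc K)) {{ℚP.normalize-nonNeg 1 (suc K)}} (ℚP.p⊓q≤q 1ℚ (frac X (suc m))))
    (frac*frac≤frac 1 K X m c L (≤-trans (≤-reflexive (cong (_* suc L) (*-identityˡ X))) XL≤cKm))


collisions-dominate : ∀ L noC coll m T → noC + coll ≡ L → noC * (m + T) ≤ L * m → L * T ≤ coll * (m + T)
collisions-dominate L noC coll m T noC+coll≡L noC-bound = +-cancelˡ-≤ (L * m) _ _ (begin
    L * m + L * T
  ≡⟨ sym (*-distribˡ-+ L m T) ⟩
    L * (m + T)
  ≡⟨ cong (_* (m + T)) (sym noC+coll≡L) ⟩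
    (noC + coll) * (m + T)
  ≡⟨ *-distribʳ-+ (m + T) noC coll ⟩
    noC * (m + T) + coll * (m + T)
  ≤⟨ +-monoˡ-≤ _ noC-bound ⟩
    L * m + coll * (m + T) ∎)
  where open ≤-Reasoning

many-collisions : ∀ L noC coll m T X C → noC + coll ≡ L → noC * (m + T) ≤ L * m → X ≤ C * T → 1 ≤ m → 1 ≤ C →
  (L ≤ (2 * C) * coll) ⊎ (X * L ≤ coll * ((2 * C) * m))
many-collisions L noC coll m T X C noC+coll≡L noC-bound X≤CT 1≤m 1≤C with m ≤? T
... | yes m≤T = inj₁ (≤-trans L≤2coll (*-monoˡ-≤ coll (*-monoʳ-≤ 2 1≤C)))
  where
  instance
    T≢0 : NonZero T
    T≢0 = >-nonZero (≤-trans 1≤m m≤T)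
  L≤2coll : L ≤ 2 * 1 * coll
  L≤2coll = *-cancelʳ-≤ L (2 * 1 * coll) T (begin
      L * T
    ≤⟨ collisions-dominate L noC coll m T noC+coll≡L noC-bound ⟩
      coll * (m + T)
    ≤⟨ *-monoʳ-≤ coll (+-monoˡ-≤ T m≤T) ⟩
      coll * (T + T)
    ≡⟨ lem coll T ⟩
      2 * 1 * coll * T ∎)
    where
    open ≤-Reasoning
    lem : ∀ c t → c * (t + t) ≡ 2 * 1 * c * t
    lem = solve-∀
... | no m≰T = inj₂ (begin
      X * L
    ≤⟨ *-monoˡ-≤ L X≤CT ⟩
      C * T * L
    ≡⟨ lem₁ C T L ⟩
      C * (L * T)
    ≤⟨ *-monoʳ-≤ C (collisions-dominate L noC coll m T noC+coll≡L noC-bound) ⟩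
      C * (coll * (m + T))
    ≤⟨ *-monoʳ-≤ C (*-monoʳ-≤ coll (+-monoʳ-≤ m (<⇒≤ (≰⇒> m≰T)))) ⟩
      C * (coll * (m + m))
    ≡⟨ lem₂ C coll m ⟩
      coll * (2 * C * m) ∎)
  where
  open ≤-Reasoning
  lem₁ : ∀ c t l → c * t * l ≡ c * (l * t)
  lem₁ = solve-∀
  lem₂ : ∀ c k m → c * (k * (m + m)) ≡ k * (2 * c * m)
  lem₂ = solve-∀

[m∸s]*[m+T+s]≤m*[m+T] : ∀ m T s → (m ∸ s) * (m + T + s) ≤ m * (m + T)
[m∸s]*[m+T+s]≤m*[m+T] m T s with s ≤? m
... | no s≰m = ≤-trans (≤-reflexive (cong (_* (m + T + s)) (m≤n⇒m∸n≡0 (<⇒≤ (≰⇒> s≰m))))) z≤n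
... | yes s≤m = begin
    (m ∸ s) * (m + T + s)
  ≡⟨ *-distribˡ-+ (m ∸ s) (m + T) s ⟩
    (m ∸ s) * (m + T) + (m ∸ s) * s
  ≤⟨ +-monoʳ-≤ ((m ∸ s) * (m + T)) (≤-trans (≤-reflexive (*-comm (m ∸ s) s)) (*-monoʳ-≤ s (≤-trans (m∸n≤m m s) (m≤m+n m T)))) ⟩
    (m ∸ s) * (m + T) + s * (m + T)
  ≡⟨ sym (*-distribʳ-+ (m + T) (m ∸ s) s) ⟩
    (m ∸ s + s) * (m + T)
  ≡⟨ cong (_* (m + T)) (m∸n+n≡m s≤m) ⟩
    m * (m + T) ∎
  where open ≤-Reasoning

halve : ∀ L → ∃[ b ] ∃[ r ] (r ≤ 1 × L ≡ (b + r) + b)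
halve zero = 0 , 0 , z≤n , refl
halve (suc zero) = 0 , 1 , ≤-refl , refl
halve (suc (suc L)) with halve L
... | b , r , r≤1 , e = suc b , r , r≤1 , trans (cong (λ z → suc (suc z)) e) (cong suc (sym (+-suc (b + r) b)))

cluster-weight-base : ∀ a b → b ≤ a → 2 * (0 + (b + (a + 0))) ≤ 4 * a
cluster-weight-base a b b≤a = begin
    2 * (0 + (b + (a + 0)))
  ≡⟨ lem a b ⟩
    2 * b + 2 * a
  ≤⟨ +-monoˡ-≤ (2 * a) (*-monoʳ-≤ 2 b≤a) ⟩
    2 * a + 2 * a
  ≡⟨ lem2 a ⟩
    4 * a ∎
  where
  open ≤-Reasoning
  lem : ∀ a b → 2 * (0 + (b + (a + 0))) ≡ 2 * b + 2 * a
  lem = solve-∀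
  lem2 : ∀ a → 2 * a + 2 * a ≡ 4 * a
  lem2 = solve-∀

cluster-weight-step : ∀ k u T → 1 ≤ u → suc (suc k) * (k + u) ≤ 4 * T →
  suc (suc (suc k)) * (suc k + u) ≤ 4 * (T + (k + u))
cluster-weight-step k (suc u') T _ h = begin
    suc (suc (suc k)) * (suc k + suc u')
  ≡⟨ lem1 k u' ⟩
    suc (suc k) * (k + suc u') + (2 * k + 4 + u')
  ≤⟨ +-mono-≤ h (≤-trans (m≤m+n _ (2 * k + 3 * u')) (≤-reflexive (lem2 k u'))) ⟩
    4 * T + 4 * (k + suc u')
  ≡⟨ sym (*-distribˡ-+ 4 T (k + suc u')) ⟩
    4 * (T + (k + suc u')) ∎
  where
  open ≤-Reasoning
  lem1 : ∀ k s → (3 + k) * (1 + k + (1 + s)) ≡ (2 + k) * (k + (1 + s)) + (2 * k + 4 + s)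
  lem1 = solve-∀
  lem2 : ∀ k s → 2 * k + 4 + s + (2 * k + 3 * s) ≡ 4 * (k + (1 + s))
  lem2 = solve-∀

random-weight-base : ∀ b r → r ≤ 1 → 1 ≤ b → (0 + (b + ((b + r) + 0))) * (0 + (b + ((b + r) + 0))) ≤ 10 * ((b + r) * b)
random-weight-base (suc c) zero _ _ = ≤-trans (m≤m+n _ (6 * ((1 + c) * (1 + c)))) (≤-reflexive (lem c))
  where
  lem : ∀ c → (0 + ((1 + c) + ((1 + c + 0) + 0))) * (0 + ((1 + c) + ((1 + c + 0) + 0))) + 6 * ((1 + c) * (1 + c)) ≡ 10 * ((1 + c + 0) * (1 + c))
  lem = solve-∀
random-weight-base (suc c) (suc zero) _ _ = ≤-trans (m≤m+n _ (6 * c * c + 18 * c + 11)) (≤-reflexive (lem c))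
  where
  lem : ∀ c → (0 + ((1 + c) + ((1 + c + 1) + 0))) * (0 + ((1 + c) + ((1 + c + 1) + 0))) + (6 * c * c + 18 * c + 11) ≡ 10 * ((1 + c + 1) * (1 + c))
  lem = solve-∀
random-weight-base (suc c) (suc (suc r)) (s≤s ()) _

2u+1≤10u : ∀ u → 1 ≤ u → 2 * u + 1 ≤ 10 * u
2u+1≤10u (suc u) _ = ≤-trans (m≤m+n _ (8 * u + 7)) (≤-reflexive (lem2 u))
  where
  lem2 : ∀ u → 2 * (1 + u) + 1 + (8 * u + 7) ≡ 10 * (1 + u)
  lem2 = solve-∀

random-weight-step : ∀ k u T → 1 ≤ u → (k + u) * (k + u) ≤ 10 * T → (suc k + u) * (suc k + u) ≤ 10 * (T + (k + u))
random-weight-step k u T 1≤u h = begin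
    (suc k + u) * (suc k + u)
  ≡⟨ lem1 k u ⟩
    (k + u) * (k + u) + (2 * (k + u) + 1)
  ≤⟨ +-monoʳ-≤ ((k + u) * (k + u)) (2u+1≤10u (k + u) (≤-trans 1≤u (m≤n+m u k))) ⟩
    (k + u) * (k + u) + 10 * (k + u)
  ≤⟨ +-monoˡ-≤ _ h ⟩
    10 * T + 10 * (k + u)
  ≡⟨ sym (*-distribˡ-+ 10 T (k + u)) ⟩
    10 * (T + (k + u)) ∎
  where
  open ≤-Reasoning
  lem1 : ∀ k s → (1 + k + s) * (1 + k + s) ≡ (k + s) * (k + s) + (2 * (k + s) + 1)
  lem1 = solve-∀

unitsThen : ℕ → ℕ → (k : ℕ) → Vec ℕ (suc (suc k))
unitsThen a b zero = b ∷ a ∷ []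
unitsThen a b (suc k) = 1 ∷ unitsThen a b k

sum-unitsThen : ∀ a b k → Vec.sum (unitsThen a b k) ≡ k + (b + (a + 0))
sum-unitsThen a b zero = refl
sum-unitsThen a b (suc k) = cong suc (sum-unitsThen a b k)

unitsThen-demands : ∀ m a b k → 1 ≤ m → 1 ≤ a → a ≤ m → 1 ≤ b → b ≤ m → All (Demand m) (unitsThen a b k)
unitsThen-demands m a b zero 1≤m 1≤a a≤m 1≤b b≤m = (1≤b , b≤m) ∷ (1≤a , a≤m) ∷ []
unitsThen-demands m a b (suc k) 1≤m 1≤a a≤m 1≤b b≤m = (≤-refl , 1≤m) ∷ unitsThen-demands m a b k 1≤m 1≤a a≤m 1≤b b≤m

sum-∷ʳ : ∀ x {j} (V : Vec ℕ j) → Vec.sum (V ∷ʳ x) ≡ Vec.sum V + x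
sum-∷ʳ x [] = +-comm x 0
sum-∷ʳ x (y ∷ V) = trans (cong (y +_) (sum-∷ʳ x V)) (sym (+-assoc y _ x))

All-∷ʳ : ∀ {P : ℕ → Set} {x j} (V : Vec ℕ j) → All P V → P x → All P (V ∷ʳ x)
All-∷ʳ [] [] px = px ∷ []
All-∷ʳ (y ∷ V) (py ∷ pV) px = py ∷ All-∷ʳ V pV px

avoidProduct-∷ʳ-full : ∀ (G : ℕ → ℕ → ℕ) m {j} (x : ℕ) (V : Vec ℕ j) → (∀ y → 1 ≤ y → G m y ≡ 0) →
  All (Demand m) (x ∷ V) → avoidProduct G ((x ∷ V) ∷ʳ m) ≡ 0
avoidProduct-∷ʳ-full G m x [] G-full ((1≤x , _) ∷ []) =
  cong (_* avoidProduct G (m ∷ [])) (trans (cong (λ s → G s x) (+-identityʳ m)) (G-full x 1≤x))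
avoidProduct-∷ʳ-full G m x (y ∷ V) G-full (_ ∷ aV) =
  trans (cong (G (Vec.sum ((y ∷ V) ∷ʳ m)) x *_) (avoidProduct-∷ʳ-full G m y V G-full aV)) (*-zeroʳ (G (Vec.sum ((y ∷ V) ∷ʳ m)) x))

demands-summing-to : ∀ m j t → 1 ≤ m → j ≤ t → t ≤ j * m → ∃[ V ] (All (Demand m) {n = j} V × Vec.sum V ≡ t)
demands-summing-to m zero t 1≤m j≤t t≤ = [] , [] , sym (n≤0⇒n≡0 t≤)
demands-summing-to m (suc j) t 1≤m j≤t t≤ with t ∸ 1 ≤? j * m
... | yes le with demands-summing-to m j (t ∸ 1) 1≤m (∸-monoˡ-≤ 1 j≤t) le
... | V , aV , sV = 1 ∷ V , (≤-refl , 1≤m) ∷ aV , trans (cong suc sV) (m+[n∸m]≡n (≤-trans (s≤s z≤n) j≤t))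
demands-summing-to m (suc j) t 1≤m j≤t t≤ | no nle with demands-summing-to m j (j * m) 1≤m (≤-trans (≤-reflexive (sym (*-identityʳ j))) (*-monoʳ-≤ j 1≤m)) ≤-refl
... | V , aV , sV = (t ∸ j * m) ∷ V , (x≥1 , x≤m) ∷ aV , trans (cong ((t ∸ j * m) +_) sV) (m∸n+n≡m (≤-trans (n≤1+n _) gt))
  where
  gt : suc (j * m) ≤ t
  gt = ≤-trans (≰⇒> nle) (m∸n≤m t 1)
  x≥1 : 1 ≤ t ∸ j * m
  x≥1 = ≤-trans (≤-reflexive (sym (m+n∸n≡m 1 (j * m)))) (∸-monoˡ-≤ (j * m) gt)
  x≤m : t ∸ j * m ≤ m
  x≤m = m≤n+o⇒m∸n≤o t (j * m) (≤-trans t≤ (≤-reflexive (+-comm m (j * m))))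

tailSums : ℕ → ℕ → ℕ → ℕ → ℕ
tailSums a b T₀ zero = T₀
tailSums a b T₀ (suc k) = tailSums a b T₀ k + Vec.sum (unitsThen a b k)

-- For the profile unitsThen a b k, tailSums a b T₀ k plays the role of the expected number of
-- colliding pairs: with the chain rule it bounds the probability of no collision by m / (m + T).
module AvoidProductBound (m : ℕ) (e : ℕ → ℕ) (G : ℕ → ℕ → ℕ) (e1≡1 : e 1 ≡ 1) (G-one : ∀ s → G s 1 ≡ m ∸ s) (a b T₀ : ℕ) where
  Ts : ℕ → ℕ
  Ts = tailSums a b T₀

  avoidProduct-bound : avoidProduct G (unitsThen a b 0) * (m + T₀) ≤ m ^ sumWith e (unitsThen a b 0) * m →
    ∀ k → avoidProduct G (unitsThen a b k) * (m + Ts k) ≤ m ^ sumWith e (unitsThen a b k) * m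
  avoidProduct-bound base zero = base
  avoidProduct-bound base (suc k) = begin
      G s 1 * PD * (m + (Ts k + s))
    ≡⟨ cong (λ z → z * PD * (m + (Ts k + s))) (G-one s) ⟩
      (m ∸ s) * PD * (m + (Ts k + s))
    ≡⟨ lem1 (m ∸ s) PD m (Ts k) s ⟩
      PD * ((m ∸ s) * (m + Ts k + s))
    ≤⟨ *-monoʳ-≤ PD ([m∸s]*[m+T+s]≤m*[m+T] m (Ts k) s) ⟩
      PD * (m * (m + Ts k))
    ≡⟨ lem2 PD m (Ts k) ⟩
      m * (PD * (m + Ts k))
    ≤⟨ *-monoʳ-≤ m (avoidProduct-bound base k) ⟩
      m * (m ^ sumWith e (unitsThen a b k) * m)
    ≡⟨ sym (*-assoc m _ m) ⟩
      m ^ (1 + sumWith e (unitsThen a b k)) * m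
    ≡⟨ cong (λ z → m ^ (z + sumWith e (unitsThen a b k)) * m) (sym e1≡1) ⟩
      m ^ (e 1 + sumWith e (unitsThen a b k)) * m ∎
    where
    open ≤-Reasoning
    s = Vec.sum (unitsThen a b k)
    PD = avoidProduct G (unitsThen a b k)
    lem1 : ∀ x p m t s → x * p * (m + (t + s)) ≡ p * (x * (m + t + s))
    lem1 = solve-∀
    lem2 : ∀ p m t → p * (m * (m + t)) ≡ m * (p * (m + t))
    lem2 = solve-∀

cluster-base : ∀ m a → (m ∸ (a + 0)) * ((m ∸ 0) * 1) * (m + a) ≤ m * (m * 1) * m
cluster-base m a = begin
    (m ∸ (a + 0)) * (m * 1) * (m + a)
  ≡⟨ cong (λ z → (m ∸ z) * (m * 1) * (m + a)) (+-identityʳ a) ⟩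
    (m ∸ a) * (m * 1) * (m + a)
  ≡⟨ lem (m ∸ a) m a ⟩
    m * ((m ∸ a) * (m + 0 + a))
  ≤⟨ *-monoʳ-≤ m ([m∸s]*[m+T+s]≤m*[m+T] m 0 a) ⟩
    m * (m * (m + 0))
  ≡⟨ lem2 m ⟩
    m * (m * 1) * m ∎
  where
  open ≤-Reasoning
  lem : ∀ x m a → x * (m * 1) * (m + a) ≡ m * (x * (m + 0 + a))
  lem = solve-∀
  lem2 : ∀ m → m * (m * (m + 0)) ≡ m * (m * 1) * m
  lem2 = solve-∀

pow-base : ∀ m s b → (m ∸ s) ^ b * (m + s * b) ≤ m ^ b * m
pow-base m s zero = ≤-reflexive (trans (+-identityʳ _) (cong (λ z → m + z) (*-zeroʳ s)))
pow-base m s (suc b) = begin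
    (m ∸ s) * X * (m + s * suc b)
  ≡⟨ lem (m ∸ s) X m s b ⟩
    X * ((m ∸ s) * (m + s * b + s))
  ≤⟨ *-monoʳ-≤ X ([m∸s]*[m+T+s]≤m*[m+T] m (s * b) s) ⟩
    X * (m * (m + s * b))
  ≡⟨ lem2 X m (m + s * b) ⟩
    m * (X * (m + s * b))
  ≤⟨ *-monoʳ-≤ m (pow-base m s b) ⟩
    m * (m ^ b * m)
  ≡⟨ sym (*-assoc m _ m) ⟩
    m * m ^ b * m ∎
  where
  open ≤-Reasoning
  X = (m ∸ s) ^ b
  lem : ∀ y x m s b → y * x * (m + s * (1 + b)) ≡ x * (y * (m + s * b + s))
  lem = solve-∀
  lem2 : ∀ x m u → x * (m * u) ≡ m * (x * u)
  lem2 = solve-∀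

random-base : ∀ m a b → (m ∸ (a + 0)) ^ b * ((m ∸ 0) ^ a * 1) * (m + a * b) ≤ m ^ (b + (a + 0)) * m
random-base m a b = begin
    (m ∸ (a + 0)) ^ b * (m ^ a * 1) * (m + a * b)
  ≡⟨ cong (λ z → (m ∸ z) ^ b * (m ^ a * 1) * (m + a * b)) (+-identityʳ a) ⟩
    (m ∸ a) ^ b * (m ^ a * 1) * (m + a * b)
  ≡⟨ lem ((m ∸ a) ^ b) (m ^ a) (m + a * b) ⟩
    m ^ a * ((m ∸ a) ^ b * (m + a * b))
  ≤⟨ *-monoʳ-≤ (m ^ a) (pow-base m a b) ⟩
    m ^ a * (m ^ b * m)
  ≡⟨ lem2 (m ^ a) (m ^ b) m ⟩
    m ^ b * m ^ a * m
  ≡⟨ cong (_* m) (sym (^-distribˡ-+-* m b a)) ⟩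
    m ^ (b + a) * m
  ≡⟨ cong (λ z → m ^ (b + z) * m) (sym (+-identityʳ a)) ⟩
    m ^ (b + (a + 0)) * m ∎
  where
  open ≤-Reasoning
  lem : ∀ x y z → x * (y * 1) * z ≡ y * (x * z)
  lem = solve-∀
  lem2 : ∀ x y m → x * (y * m) ≡ y * x * m
  lem2 = solve-∀

cluster-weight : ∀ a b → b ≤ a → 1 ≤ b → ∀ k → suc (suc k) * (k + (b + (a + 0))) ≤ 4 * tailSums a b a k
cluster-weight a b b≤a 1≤b zero = cluster-weight-base a b b≤a
cluster-weight a b b≤a 1≤b (suc k) = subst (λ z → suc (suc (suc k)) * (suc k + (b + (a + 0))) ≤ 4 * (tailSums a b a k + z)) (sym (sum-unitsThen a b k))
   (cluster-weight-step k (b + (a + 0)) (tailSums a b a k) (≤-trans 1≤b (m≤m+n b _)) (cluster-weight a b b≤a 1≤b k))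

random-weight : ∀ b r → r ≤ 1 → 1 ≤ b → ∀ k → (k + (b + ((b + r) + 0))) * (k + (b + ((b + r) + 0))) ≤ 10 * tailSums (b + r) b ((b + r) * b) k
random-weight b r r≤1 1≤b zero = random-weight-base b r r≤1 1≤b
random-weight b r r≤1 1≤b (suc k) = subst (λ z → (suc k + SS) * (suc k + SS) ≤ 10 * (tailSums (b + r) b ((b + r) * b) k + z)) (sym (sum-unitsThen (b + r) b k))
   (random-weight-step k SS (tailSums (b + r) b ((b + r) * b) k) (≤-trans 1≤b (m≤m+n b _)) (random-weight b r r≤1 1≤b k))
  where SS = b + ((b + r) + 0)


∑-lookup : ∀ {n} (D : Vec ℕ n) → ∑ (lookup D) (allFin n) ≡ Vec.sum D
∑-lookup [] = refl
∑-lookup (x ∷ D) = trans (∑-allFin-suc (lookup (x ∷ D))) (cong (x +_) (∑-lookup D))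

∑∑-lookup-+ : ∀ {n} (D : Vec ℕ n) → ∑ (λ i → ∑ (λ j → lookup D i + lookup D j) (allFin n)) (allFin n) ≡ 2 * (n * Vec.sum D)
∑∑-lookup-+ {n} D = begin
    ∑ (λ i → ∑ (λ j → lookup D i + lookup D j) Fs) Fs
  ≡⟨ ∑-cong Fs (λ i _ → trans (∑-+ (λ _ → lookup D i) (lookup D) Fs) (cong₂ _+_ (∑-const (lookup D i) Fs) (∑-lookup D))) ⟩
    ∑ (λ i → lookup D i * length Fs + Vec.sum D) Fs
  ≡⟨ ∑-+ (λ i → lookup D i * length Fs) (λ _ → Vec.sum D) Fs ⟩
    ∑ (λ i → lookup D i * length Fs) Fs + ∑ (λ _ → Vec.sum D) Fs
  ≡⟨ cong₂ _+_ (trans (∑-*ʳ (length Fs) (lookup D) Fs) (cong (_* length Fs) (∑-lookup D))) (∑-const (Vec.sum D) Fs) ⟩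
    Vec.sum D * length Fs + Vec.sum D * length Fs
  ≡⟨ cong (λ z → Vec.sum D * z + Vec.sum D * z) (length-allFin n) ⟩
    Vec.sum D * n + Vec.sum D * n
  ≡⟨ lem (Vec.sum D) n ⟩
    2 * (n * Vec.sum D) ∎
  where
  open ≡-Reasoning
  Fs = allFin n
  lem : ∀ s n → s * n + s * n ≡ 2 * (n * s)
  lem = solve-∀

∑∑-lookup-* : ∀ {n} (D : Vec ℕ n) → ∑ (λ i → ∑ (λ j → lookup D i * lookup D j) (allFin n)) (allFin n) ≡ Vec.sum D * Vec.sum D
∑∑-lookup-* {n} D = trans (∑-cong (allFin n) (λ i _ → trans (∑-*ˡ (lookup D i) (lookup D) (allFin n)) (cong (lookup D i *_) (∑-lookup D))))
                    (trans (∑-*ʳ (Vec.sum D) (lookup D) (allFin n)) (cong (_* Vec.sum D) (∑-lookup D)))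

a+a≤1+[m+m]⇒a≤m : ∀ a m → a + a ≤ suc (m + m) → a ≤ m
a+a≤1+[m+m]⇒a≤m a m h with a ≤? m
... | yes a≤m = a≤m
... | no a≰m = ⊥-elim (<-irrefl refl (≤-trans (s≤s (≤-reflexive (sym (+-suc m m)))) (≤-trans (+-mono-≤ (≰⇒> a≰m) (≰⇒> a≰m)) h)))

halve-pos : ∀ b r → r ≤ 1 → 2 ≤ b + r + b → 1 ≤ b
halve-pos zero zero _ ()
halve-pos zero (suc zero) _ (s≤s ())
halve-pos zero (suc (suc r)) (s≤s ()) _
halve-pos (suc b) r _ _ = s≤s z≤n

small-profile : ∀ k d m → suc (suc k) ≤ d → d ∸ k ≤ m + m →
  ∃[ b ] ∃[ r ] (r ≤ 1 × 1 ≤ b × b + r ≤ m × k + (b + ((b + r) + 0)) ≡ d)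
small-profile k d m n≤d L≤ with halve (d ∸ k)
... | b , r , r≤1 , e = b , r , r≤1 , 1≤b , a≤m , sumEq
  where
  k≤d : k ≤ d
  k≤d = ≤-trans (n≤1+n k) (≤-trans (n≤1+n (suc k)) n≤d)
  L≥2 : 2 ≤ d ∸ k
  L≥2 = subst (_≤ d ∸ k) (m+n∸n≡m 2 k) (∸-monoˡ-≤ k n≤d)
  1≤b : 1 ≤ b
  1≤b = halve-pos b r r≤1 (subst (2 ≤_) e L≥2)
  a≤m : b + r ≤ m
  a≤m = a+a≤1+[m+m]⇒a≤m (b + r) m (≤-trans (≤-reflexive (lem b r)) (≤-trans (+-monoʳ-≤ (b + r + b) r≤1) (≤-trans (≤-reflexive (trans (cong (_+ 1) (sym e)) (+-comm (d ∸ k) 1))) (s≤s L≤))))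
    where
    lem : ∀ b r → b + r + (b + r) ≡ b + r + b + r
    lem = solve-∀
  sumEq : k + (b + ((b + r) + 0)) ≡ d
  sumEq = trans (cong (k +_) (trans (lem b r) (sym e))) (m+[n∸m]≡n k≤d)
    where
    lem : ∀ b r → b + ((b + r) + 0) ≡ b + r + b
    lem = solve-∀

large-profile : ∀ k d m → 1 ≤ m → ¬ (d ∸ k ≤ m + m) → d ≤ suc (suc k) * m →
  ∃[ V ] (All (Demand m) {n = suc k} V × Vec.sum V ≡ d ∸ m)
large-profile k d m 1≤m nL d≤ = demands-summing-to m (suc k) (d ∸ m) 1≤m sk≤ (m≤n+o⇒m∸n≤o d m d≤)
  where
  gt : suc (m + m) ≤ d ∸ k
  gt = ≰⇒> nL
  k≤d : k ≤ d
  k≤d = <⇒≤ (m∸n≢0⇒n<m (λ d∸k≡0 → n≮0 (subst (suc (m + m) ≤_) d∸k≡0 gt)))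
  h1 : suc (m + m) + k ≤ d
  h1 = ≤-trans (+-monoˡ-≤ k gt) (≤-reflexive (m∸n+n≡m k≤d))
  h2 : suc k + m ≤ d
  h2 = ≤-trans (≤-trans (≤-reflexive (lem k m)) (+-monoˡ-≤ k (s≤s (m≤n+m m m)))) h1
    where
    lem : ∀ k m → suc k + m ≡ suc m + k
    lem = solve-∀
  sk≤ : suc k ≤ d ∸ m
  sk≤ = ≤-trans (≤-reflexive (sym (m+n∸n≡m (suc k) m))) (∸-monoˡ-≤ m h2)


module LowerBound (m' : ℕ) (A : List (Perm (suc m'))) (e : ℕ → ℕ) (G : ℕ → ℕ → ℕ)
  (hyp : ∀ d → 1 ≤ d → d ≤ suc m' → (Sl : List (Fin (suc m'))) → Unique Sl →
         suc m' ^ e d * countᵇ (λ σ → not (intersects (outputs σ d) Sl)) A ≤ length A * G (length Sl) d)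
  (inj : ∀ σ → σ ∈ A → ∀ {s t} → lookup σ s ≡ lookup σ t → s ≡ t)
  (nonempty : 1 ≤ length A) where

  private
    m = suc m'

  collProb-lower : ∀ {n} (D : Vec ℕ n) → All (Demand m) D → (T X C' : ℕ) →
     avoidProduct G D * (m + T) ≤ m ^ sumWith e D * m → X ≤ suc C' * T →
     frac 1 (2 * suc C') ℚ.* (1ℚ ⊓ frac X m) ℚ.≤ collProb A D
  collProb-lower {n} D aD T X C' avoidance X≤CT =
    frac*[1⊓frac]≤frac (2 * suc C') coll L X m dichotomy (s≤s z≤n) (m^n>0 (length A) {{>-nonZero nonempty}} n) (s≤s z≤n)
    where
    L = length A ^ n
    noC = countᵇ (λ v → not (collides D v)) (vecsOf A n)
    coll = countColl A D
    noC+coll≡L : noC + coll ≡ L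
    noC+coll≡L = trans (cong (noC +_) (countColl≡countᵇ A D)) (trans (countᵇ-not+countᵇ (collides D) (vecsOf A n)) (length-vecsOf A n))
    chain : m ^ sumWith e D * noC ≤ L * avoidProduct G D
    chain = chain-rule-bound A e G hyp inj D aD
    instance
      nzE : NonZero (m ^ sumWith e D)
      nzE = >-nonZero (m^n>0 m (sumWith e D))
    bound : noC * (m + T) ≤ L * m
    bound = *-cancelˡ-≤ (m ^ sumWith e D) (begin
        m ^ sumWith e D * (noC * (m + T))
      ≡⟨ sym (*-assoc (m ^ sumWith e D) noC (m + T)) ⟩
        m ^ sumWith e D * noC * (m + T)
      ≤⟨ *-monoˡ-≤ (m + T) chain ⟩
        L * avoidProduct G D * (m + T)
      ≡⟨ *-assoc L (avoidProduct G D) (m + T) ⟩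
        L * (avoidProduct G D * (m + T))
      ≤⟨ *-monoʳ-≤ L avoidance ⟩
        L * (m ^ sumWith e D * m)
      ≡⟨ lem L (m ^ sumWith e D) m ⟩
        m ^ sumWith e D * (L * m) ∎)
      where
      open ≤-Reasoning
      lem : ∀ l p m → l * (p * m) ≡ p * (l * m)
      lem = solve-∀
    dichotomy : (L ≤ 2 * suc C' * coll) ⊎ (X * L ≤ coll * (2 * suc C' * m))
    dichotomy = many-collisions L noC coll m T X (suc C') noC+coll≡L bound X≤CT (s≤s z≤n) (s≤s z≤n)

  collProb-lower-full : (∀ y → 1 ≤ y → G m y ≡ 0) → ∀ k d X C' → ¬ (d ∸ k ≤ m + m) → d ≤ suc (suc k) * m →
    ∃[ D ] (InD1 m (suc (suc k)) d D × frac 1 (2 * suc C') ℚ.* (1ℚ ⊓ frac X m) ℚ.≤ collProb A D)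
  collProb-lower-full G-full k d X C' big d≤ with large-profile k d m (s≤s z≤n) big d≤
  ... | x ∷ V , aV , sumV =
    D , (All-∷ʳ (x ∷ V) aV (s≤s z≤n , ≤-refl) , sum≡d) , collProb-lower D (All-∷ʳ (x ∷ V) aV (s≤s z≤n , ≤-refl)) X X C' noAvoid (m≤m+n X _)
    where
    D = (x ∷ V) ∷ʳ m
    m≤d : m ≤ d
    m≤d = ≤-trans (m≤m+n m m) (<⇒≤ (≤-trans (≰⇒> big) (m∸n≤m d k)))
    sum≡d : Vec.sum D ≡ d
    sum≡d = trans (sum-∷ʳ m (x ∷ V)) (trans (cong (_+ m) sumV) (m∸n+n≡m m≤d))
    noAvoid : avoidProduct G D * (m + X) ≤ m ^ sumWith e D * m
    noAvoid = ≤-trans (≤-reflexive (cong (_* (m + X)) (avoidProduct-∷ʳ-full G m x V G-full aV))) z≤n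

  collProb-lower-balanced : e 1 ≡ 1 → (∀ s → G s 1 ≡ m ∸ s) →
    ∀ k d a b T₀ X C' → 1 ≤ b → b ≤ a → a ≤ m → k + (b + (a + 0)) ≡ d →
    avoidProduct G (b ∷ a ∷ []) * (m + T₀) ≤ m ^ sumWith e (b ∷ a ∷ []) * m →
    X ≤ suc C' * tailSums a b T₀ k →
    ∃[ D ] (InD1 m (suc (suc k)) d D × frac 1 (2 * suc C') ℚ.* (1ℚ ⊓ frac X m) ℚ.≤ collProb A D)
  collProb-lower-balanced e1≡1 G-one k d a b T₀ X C' 1≤b b≤a a≤m sum≡d base X≤ =
    D , (aD , trans (sum-unitsThen a b k) sum≡d) ,
    collProb-lower D aD (tailSums a b T₀ k) X C' (AvoidProductBound.avoidProduct-bound m e G e1≡1 G-one a b T₀ base k) X≤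
    where
    D = unitsThen a b k
    aD = unitsThen-demands m a b k (s≤s z≤n) (≤-trans 1≤b b≤a) a≤m 1≤b (≤-trans b≤a a≤m)

module UpperBound (m' : ℕ) (A : List (Perm (suc m'))) (nonempty : 1 ≤ length A) where
  private
    m = suc m'

  collProb-upper : ∀ k (D : Vec ℕ (suc (suc k))) (X : ℕ) (w : Fin (suc (suc k)) → Fin (suc (suc k)) → ℕ) →
       (∀ i j → i ≢ j → m * ∑ (λ σ → ∑ (λ τ → 𝟙 (intersects (outputs σ (lookup D i)) (outputs τ (lookup D j)))) A) A ≤ w i j * length A ^ 2) →
       ∑ (λ i → ∑ (w i) (allFin (suc (suc k)))) (allFin (suc (suc k))) ≤ 2 * X →
       collProb A D ℚ.≤ frac 2 1 ℚ.* (1ℚ ⊓ frac X m)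
  collProb-upper k D X w h hW =
    frac≤2*[1⊓frac] coll (length A ^ suc (suc k)) X m coll≤L m*coll≤2XL (m^n>0 (length A) {{>-nonZero nonempty}} (suc (suc k))) (s≤s z≤n)
    where
    coll = countColl A D
    coll≤L : coll ≤ length A ^ suc (suc k)
    coll≤L = ≤-trans (≤-reflexive (countColl≡countᵇ A D)) (≤-trans (countᵇ≤length (collides D) (vecsOf A (suc (suc k)))) (≤-reflexive (length-vecsOf A (suc (suc k)))))
    m*coll≤2XL : m * coll ≤ 2 * X * length A ^ suc (suc k)
    m*coll≤2XL = ≤-trans (union-bound A k D w h) (*-monoˡ-≤ _ hW)

d≤n*0-absurd : ∀ {n d} → 2 ≤ n → n ≤ d → d ≤ n * 0 → ⊥
d≤n*0-absurd {n} 2≤n n≤d d≤n*0 = <-irrefl refl (≤-trans (≤-trans (s≤s z≤n) (≤-trans 2≤n n≤d)) (≤-trans d≤n*0 (≤-reflexive (*-zeroʳ n))))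

cluster-pairs-bound : ∀ m' (a b : ℕ) →
  suc m' * ∑ (λ σ → countᵇ (λ τ → intersects (outputs σ a) (outputs τ b)) (cluster (suc m'))) (cluster (suc m'))
    ≤ (a + b) * length (cluster (suc m')) ^ 2
cluster-pairs-bound m' a b = begin
    m * ∑ (λ σ → countᵇ (λ τ → intersects (outputs σ a) (outputs τ b)) A) A
  ≤⟨ *-monoʳ-≤ m (∑-mono A (λ σ σ∈ → cluster-pair-bound m' σ σ∈ a b)) ⟩
    m * ∑ (λ _ → a + b) A
  ≡⟨ cong (m *_) (∑-const (a + b) A) ⟩
    m * ((a + b) * length A)
  ≡⟨ cong (λ z → z * ((a + b) * length A)) (sym (length-cluster m')) ⟩
    length A * ((a + b) * length A)
  ≡⟨ lem (length A) (a + b) ⟩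
    (a + b) * length A ^ 2 ∎
  where
  open ≤-Reasoning
  m = suc m'
  A = cluster m
  lem : ∀ l w → l * (w * l) ≡ w * (l * (l * 1))
  lem = solve-∀

random-pairs-bound : ∀ {m} (a b : ℕ) → a ≤ m → b ≤ m →
  m * ∑ (λ σ → countᵇ (λ τ → intersects (outputs σ a) (outputs τ b)) (random m)) (random m)
    ≤ (a * b) * length (random m) ^ 2
random-pairs-bound {m} a b a≤m b≤m = begin
    m * ∑ (λ σ → countᵇ (λ τ → intersects (outputs σ a) (outputs τ b)) A) A
  ≡⟨ sym (∑-*ˡ m _ A) ⟩
    ∑ (λ σ → m * countᵇ (λ τ → intersects (outputs σ a) (outputs τ b)) A) A
  ≤⟨ ∑-mono A (λ σ σ∈ → random-pair-bound σ σ∈ a b a≤m b≤m) ⟩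
    ∑ (λ _ → a * b * length A) A
  ≡⟨ ∑-const _ A ⟩
    a * b * length A * length A
  ≡⟨ lem (a * b) (length A) ⟩
    (a * b) * length A ^ 2 ∎
  where
  open ≤-Reasoning
  A = random m
  lem : ∀ w l → w * l * l ≡ w * (l * (l * 1))
  lem = solve-∀

cluster-bounds : ∀ m n d → 2 ≤ n → n ≤ d → d ≤ n * m →
  MaxBetween m n d (collProb (cluster m)) (frac 1 8) (frac 2 1) (1ℚ ⊓ frac (n * d) m)
cluster-bounds zero n d 2≤n n≤d d≤n*0 = ⊥-elim (d≤n*0-absurd 2≤n n≤d d≤n*0)
cluster-bounds m@(suc m') n@(suc (suc k)) d (s≤s (s≤s z≤n)) n≤d d≤nm = lower , upper
  where
  A = cluster m
  nonempty : 1 ≤ length A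
  nonempty = subst (1 ≤_) (sym (length-cluster m')) (s≤s z≤n)
  open LowerBound m' A (λ _ → 1) (λ s _ → m ∸ s) (cluster-avoid-bound m') (cluster-injective m') nonempty
  lower : ∃[ D ] (InD1 m n d D × frac 1 8 ℚ.* (1ℚ ⊓ frac (n * d) m) ℚ.≤ collProb A D)
  lower with d ∸ k ≤? m + m
  ... | no big = collProb-lower-full (λ _ _ → n∸n≡0 m) k d (n * d) 3 big d≤nm
  ... | yes small with small-profile k d m n≤d small
  ... | b , r , r≤1 , 1≤b , b+r≤m , sum≡d =
    collProb-lower-balanced refl (λ _ → refl) k d (b + r) b (b + r) (n * d) 3 1≤b (m≤m+n b r) b+r≤m sum≡d (cluster-base m (b + r))
      (subst (λ z → n * z ≤ 4 * tailSums (b + r) b (b + r) k) sum≡d (cluster-weight (b + r) b (m≤m+n b r) 1≤b k))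
  upper : ∀ D → InD1 m n d D → collProb A D ℚ.≤ frac 2 1 ℚ.* (1ℚ ⊓ frac (n * d) m)
  upper D (_ , sum≡d) =
    UpperBound.collProb-upper m' A nonempty k D (n * d) (λ i j → lookup D i + lookup D j)
      (λ i j _ → cluster-pairs-bound m' (lookup D i) (lookup D j))
      (≤-reflexive (trans (∑∑-lookup-+ D) (cong (λ z → 2 * (n * z)) sum≡d)))

random-bounds : ∀ m n d → 2 ≤ n → n ≤ d → d ≤ n * m →
  MaxBetween m n d (collProb (random m)) (frac 1 20) (frac 2 1) (1ℚ ⊓ frac (d * d) m)
random-bounds zero n d 2≤n n≤d d≤n*0 = ⊥-elim (d≤n*0-absurd 2≤n n≤d d≤n*0)
random-bounds m@(suc m') n@(suc (suc k)) d (s≤s (s≤s z≤n)) n≤d d≤nm = lower , upper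
  where
  A = random m
  nonempty : 1 ≤ length A
  nonempty = subst (1 ≤_) (sym (length-allPerms {m})) (1≤falling-self m)
  open LowerBound m' A (λ d → d) (λ s d → (m ∸ s) ^ d) (random-avoid-bound {m}) (random-injective {m}) nonempty
  lower : ∃[ D ] (InD1 m n d D × frac 1 20 ℚ.* (1ℚ ⊓ frac (d * d) m) ℚ.≤ collProb A D)
  lower with d ∸ k ≤? m + m
  ... | no big = collProb-lower-full (λ { (suc y) _ → cong (_^ suc y) (n∸n≡0 m) }) k d (d * d) 9 big d≤nm
  ... | yes small with small-profile k d m n≤d small
  ... | b , r , r≤1 , 1≤b , b+r≤m , sum≡d =
    collProb-lower-balanced refl (λ s → *-identityʳ (m ∸ s)) k d (b + r) b ((b + r) * b) (d * d) 9 1≤b (m≤m+n b r) b+r≤m sum≡d (random-base m (b + r) b)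
      (subst (λ z → z * z ≤ 10 * tailSums (b + r) b ((b + r) * b) k) sum≡d (random-weight b r r≤1 1≤b k))
  upper : ∀ D → InD1 m n d D → collProb A D ℚ.≤ frac 2 1 ℚ.* (1ℚ ⊓ frac (d * d) m)
  upper D (aD , sum≡d) =
    UpperBound.collProb-upper m' A nonempty k D (d * d) (λ i j → lookup D i * lookup D j)
      (λ i j _ → random-pairs-bound (lookup D i) (lookup D j) (proj₂ (lookup⁺ aD i)) (proj₂ (lookup⁺ aD j)))
      (≤-trans (≤-reflexive (trans (∑∑-lookup-* D) (cong₂ _*_ sum≡d sum≡d))) (m≤m+n (d * d) _))

corollary3p5 : (∃[ c₁ ] ∃[ c₂ ] (0ℚ ℚ.< c₁ × 0ℚ ℚ.< c₂ ×
    (∀ m n d → 2 ≤ n → n ≤ d → d ≤ n * m →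
    MaxBetween m n d (collProb (cluster m)) c₁ c₂ (1ℚ ⊓ frac (n * d) m))))
    ×
    (∃[ c₁ ] ∃[ c₂ ] (0ℚ ℚ.< c₁ × 0ℚ ℚ.< c₂ ×
    (∀ m n d → 2 ≤ n → n ≤ d → d ≤ n * m →
    MaxBetween m n d (collProb (random m)) c₁ c₂ (1ℚ ⊓ frac (d * d) m))))
corollary3p5 = (frac 1 8 , frac 2 1 , toWitness {a? = 0ℚ ℚP.<? frac 1 8} tt , toWitness {a? = 0ℚ ℚP.<? frac 2 1} tt , cluster-bounds)
             , (frac 1 20 , frac 2 1 , toWitness {a? = 0ℚ ℚP.<? frac 1 20} tt , toWitness {a? = 0ℚ ℚP.<? frac 2 1} tt , random-bounds)
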